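{- Let $p\ge1$, $r_1\le\cdots\le r_p$ nonnegative integers, $\mathbf{r}_p=(r_1,\ldots,r_p)$, and $\mathbf{e}_p=(0,\ldots,0,1)\in\mathbb{R}^p$. For all integers $n,m\ge0$, $$B_{n+m}(z;\mathbf{r}_p)=\sum_{j=0}^{n}{n+r_p\brace j+r_p}_{r_p}z^jB_m(z;\mathbf{r}_p+j\mathbf{e}_p),$$ $$B_{n+m}(z;\mathbf{r}_p)=\sum_{i=0}^{|\mathbf{r}_{p-1}|}\sum_{j=0}^{n}{n+r_p\brace j+r_p}_{r_p}a_i(\mathbf{r}_{p-1})z^jB_{m+i}(z;r_p+j),$$ $$z^nB_m(z;\mathbf{r}_p+n\mathbf{e}_p)=\sum_{j=0}^{n}\genfrac{[}{]}{0pt}{}{n+r_p}{j+r_p}_{r_p}(-1)^{n-j}B_{m+j}(z;\mathbf{r}_p).$$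
   Context: For a vector $\mathbf{s}=(s_1,\ldots,s_m)$ of nonnegative integers, $|\mathbf{s}|=s_1+\cdots+s_m$; let $S_1=\{1,\ldots,s_1\}$, $S_2=\{s_1+1,\ldots,s_1+s_2\}$, etc. ${N\brace k}_{\mathbf{s}}$ is the number of partitions of $\{1,\ldots,N\}$ into $k$ nonempty blocks such that for each $i$ the elements of $S_i$ lie in distinct blocks, and $B_n(z;\mathbf{s})=\sum_{k=0}^{n+s_1+\cdots+s_{m-1}}{n+|\mathbf{s}|\brace k+s_m}_{\mathbf{s}}z^k$; for a single integer $r$, ${N\brace k}_r$ is Broder's $r$-Stirling number of the second kind and $B_n(z;r)=\sum_{k=0}^n{n+r\brace k+r}_rz^k$ the $r$-Bell polynomial. $\genfrac{[}{]}{0pt}{}{N}{k}_{r}$ is Broder's $r$-Stirling number of the first kind: the number of permutations of $\{1,\ldots,N\}$ with $k$ cycles such that $1,\ldots,r$ lie in distinct cycles. With $\genfrac{[}{]}{0pt}{}{n}{k}$ unsigned Stirling numbers of the first kind, $a_i(\mathbf{r}_{p-1})=(-1)^{|\mathbf{r}_{p-1}|-i}\sum_{j_1+\cdots+j_{p-1}=i}\genfrac{[}{]}{0pt}{}{r_1}{j_1}\cdots\genfrac{[}{]}{0pt}{}{r_{p-1}}{j_{p-1}}$, where $|\mathbf{r}_{p-1}|=r_1+\cdots+r_{p-1}$. -}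

module Defs where

open import Data.Nat as ℕ using (ℕ; zero; suc; _+_; _∸_; _≤ᵇ_; _≡ᵇ_)
open import Data.Bool using (Bool; true; false; _∧_; if_then_else_)
open import Data.List as List using (List; []; _∷_; _++_; [_]; length; concatMap; filterᵇ; map)
open import Data.Vec as Vec using (Vec; []; _∷_; _∷ʳ_; init; last; toList)
open import Data.Integer as ℤ using (ℤ; +_; -_)
open import Relation.Binary.PropositionalEquality using (_≡_)
open import Data.Nat.ListAction using (sum)

allᵇ : {A : Set} → (A → Bool) → List A → Bool
allᵇ p [] = true
allᵇ p (x ∷ xs) = p x ∧ allᵇ p xs

-- Every set partition of {1,…,N} occurs exactly once in
-- `setPartitions N`: a partition of {1,…,N+1} is obtained from a unique
-- partition of {1,…,N} by adding N+1 to one of its blocks or as a new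
-- singleton block.

addToBlock : ℕ → List (List ℕ) → List (List (List ℕ))
addToBlock x [] = []
addToBlock x (b ∷ bs) = ((x ∷ b) ∷ bs) ∷ map (b ∷_) (addToBlock x bs)

setPartitions : ℕ → List (List (List ℕ))
setPartitions zero = [] ∷ []
setPartitions (suc N) =
  concatMap (λ P → addToBlock (suc N) P ++ [ P ++ [ suc N ∷ [] ] ]) (setPartitions N)

countIn : ℕ → ℕ → List ℕ → ℕ
countIn lo hi [] = 0
countIn lo hi (x ∷ xs) =
  (if (suc lo ≤ᵇ x) ∧ (x ≤ᵇ hi) then 1 else 0) + countIn lo hi xs

-- the intervals S_1 = {1..s_1}, S_2 = {s_1+1..s_1+s_2}, … encoded as
-- pairs (lo , hi) meaning {lo+1,…,hi}; `off` is the starting offset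
data Pair : Set where
  ⟨_,_⟩ : ℕ → ℕ → Pair

intervals : ℕ → List ℕ → List Pair
intervals off [] = []
intervals off (s ∷ ss) = ⟨ off , off + s ⟩ ∷ intervals (off + s) ss

blockOK : List Pair → List ℕ → Bool
blockOK Is b = allᵇ (λ { ⟨ lo , hi ⟩ → countIn lo hi b ≤ᵇ 1 }) Is

countᵇ : {A : Set} → (A → Bool) → List A → ℕ
countᵇ p xs = length (filterᵇ p xs)

-- {N brace k}_s : partitions of {1..N} into k nonempty blocks such that
-- for each i the elements of S_i lie in distinct blocks
stirling2s : ℕ → ℕ → List ℕ → ℕ
stirling2s N k s =
  countᵇ (λ P → (length P ≡ᵇ k) ∧ allᵇ (blockOK (intervals 0 s)) P) (setPartitions N)

rStirling2 : ℕ → ℕ → ℕ → ℕ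
rStirling2 N k r = stirling2s N k (r ∷ [])

-- Permutations of {1,…,N} in cycle notation (list of cycles, each cycle a
-- list).  A permutation of {1..N+1} arises uniquely from one of {1..N} by
-- making N+1 a fixed point (new cycle) or inserting N+1 directly after
-- some element in its cycle.

insertAfterEach : ℕ → List ℕ → List (List ℕ)
insertAfterEach x [] = []
insertAfterEach x (a ∷ as) = (a ∷ x ∷ as) ∷ map (a ∷_) (insertAfterEach x as)

addToCycle : ℕ → List (List ℕ) → List (List (List ℕ))
addToCycle x [] = []
addToCycle x (c ∷ cs) =
  map (_∷ cs) (insertAfterEach x c) ++ map (c ∷_) (addToCycle x cs)

permutationsCyc : ℕ → List (List (List ℕ))
permutationsCyc zero = [] ∷ []
permutationsCyc (suc N) =
  concatMap (λ C → addToCycle (suc N) C ++ [ C ++ [ suc N ∷ [] ] ]) (permutationsCyc N)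

rStirling1 : ℕ → ℕ → ℕ → ℕ
rStirling1 N k r =
  countᵇ (λ C → (length C ≡ᵇ k) ∧ allᵇ (λ c → countIn 0 r c ≤ᵇ 1) C) (permutationsCyc N)

stirling1 : ℕ → ℕ → ℕ
stirling1 zero zero = 1
stirling1 zero (suc k) = 0
stirling1 (suc n) zero = 0
stirling1 (suc n) (suc k) = n ℕ.* stirling1 n (suc k) + stirling1 n k

sumℕ : ℕ → (ℕ → ℕ) → ℕ
sumℕ zero f = f 0
sumℕ (suc n) f = sumℕ n f + f (suc n)

compSum : List ℕ → ℕ → ℕ
compSum [] i = if i ≡ᵇ 0 then 1 else 0
compSum (r ∷ rs) i = sumℕ i (λ j → stirling1 r j ℕ.* compSum rs (i ∸ j))

signPow : ℕ → ℤ
signPow zero = + 1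
signPow (suc e) = - signPow e

aCoeff : ℕ → List ℕ → ℤ
aCoeff i rs = signPow (sum rs ∸ i) ℤ.* (+ compSum rs i)

-- Polynomials in z with integer coefficients, as coefficient sequences
-- (coefficient of z^k at k; finitely supported in all uses below).

Poly : Set
Poly = ℕ → ℤ

_≈ₚ_ : Poly → Poly → Set
f ≈ₚ g = ∀ k → f k ≡ g k

infix 4 _≈ₚ_

_+ₚ_ : Poly → Poly → Poly
(f +ₚ g) k = f k ℤ.+ g k

_·ₚ_ : ℤ → Poly → Poly
(c ·ₚ f) k = c ℤ.* f k

zPow·_ : ℕ → Poly → Poly
(zPow· j) f k = if j ≤ᵇ k then f (k ∸ j) else + 0

sumₚ : ℕ → (ℕ → Poly) → Poly
sumₚ zero F = F 0
sumₚ (suc n) F = sumₚ n F +ₚ F (suc n)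

Bpoly : ∀ {q} → ℕ → Vec ℕ (suc q) → Poly
Bpoly n s k =
  if k ≤ᵇ n + Vec.sum (init s)
  then + stirling2s (n + Vec.sum s) (k + last s) (toList s)
  else + 0

rBell : ℕ → ℕ → Poly
rBell n r k = if k ≤ᵇ n then + rStirling2 (n + r) (k + r) r else + 0

addLast : ∀ {q} → ℕ → Vec ℕ (suc q) → Vec ℕ (suc q)
addLast j s = init s ∷ʳ (last s + j)

module Submission where

-- Represent a polynomial by its coefficient sequence and let U c f = z f + z f′ − c f.
-- Adding N + 1 to the partitions of {1, …, N} multiplies their generating polynomial
-- by U c, where c counts the elements of the interval of N + 1 below it: they lie in
-- distinct blocks, which N + 1 may not join.  Hence B_M(z; r) is obtained by applying
-- U₀^M (U_{r_p − 1} ⋯ U₁ U₀) to the polynomial Φ of the partitions of {1, …, |r_{p−1}|},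
-- and Φ = Π_{l<p} (U₀)_{r_l} 1 = Σ_i a_i U₀^i 1 is a product of falling factorials.
-- Since U c = U₀ − c, all these operators commute, and the three identities are the
-- changes of basis between the powers of U₀ and the falling products
-- (U₀ − t)(U₀ − t − 1)⋯(U₀ − t − n + 1), whose coefficients are the r-Stirling numbers
-- of the second kind and the signed r-Stirling numbers of the first kind.

open import Defs
open import Data.Nat using (ℕ; _≤_; _+_; _∸_)
open import Data.Nat as ℕ using (zero; suc; _*_; _<_; z≤n; s≤s; _≤ᵇ_; _<ᵇ_; _≡ᵇ_)
import Data.Nat.Properties as ℕₚ
open import Data.Nat.ListAction using (sum)
open import Data.Nat.ListAction.Properties using (sum-++)
open import Data.Nat.Tactic.RingSolver using (solve-∀)
open import Data.Bool using (Bool; true; false; _∧_; _∨_; not; if_then_else_; T)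
import Data.Bool.Properties as Boolₚ
open import Data.List using (List; []; _∷_; _++_; length; concatMap; map; foldr; replicate; applyDownFrom)
import Data.List.Properties as Listₚ
open import Data.List.Relation.Unary.All as All using (All; []; _∷_)
import Data.List.Relation.Unary.All.Properties as Allₚ
open import Data.Integer as ℤ using (ℤ; +_; -_)
import Data.Integer.Properties as ℤₚ
import Data.Integer.Tactic.RingSolver as ℤ-Solver
open import Data.Product using (_×_; _,_; proj₁; proj₂)
open import Data.Sum using (inj₁; inj₂)
open import Data.Unit using (tt)
open import Data.Empty using (⊥-elim)
open import Function using (_∘_)
open import Algebra.Bundles using (CommutativeMonoid)
import Algebra.Properties.CommutativeSemigroup as CommSemigroupProperties
open import Relation.Nullary using (¬_; Dec; yes; no)
open import Relation.Binary.PropositionalEquality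
  using (_≡_; refl; sym; trans; cong; cong₂; subst; module ≡-Reasoning; _→-setoid_)
import Relation.Binary.Reasoning.Setoid as SetoidReasoning
open import Data.Vec using (Vec; lookup; init; last; toList)
open import Data.Fin as Fin using (Fin)
import Data.Vec as Vec
import Data.Vec.Properties as Vecₚ

private variable
  A B : Set

open CommSemigroupProperties (CommutativeMonoid.commutativeSemigroup Boolₚ.∧-commutativeMonoid)
  using () renaming (interchange to ∧-interchange)
open CommSemigroupProperties ℕₚ.+-commutativeSemigroup
  using () renaming (x∙yz≈y∙xz to +-left-comm; xy∙z≈xz∙y to +-right-comm; interchange to +-interchange)

[_]ᵇ : Bool → ℕ
[ b ]ᵇ = if b then 1 else 0

[∧]ᵇ : ∀ a b → [ a ∧ b ]ᵇ ≡ [ a ]ᵇ * [ b ]ᵇ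
[∧]ᵇ true b = sym (ℕₚ.+-identityʳ [ b ]ᵇ)
[∧]ᵇ false b = refl

T⇒≡true : ∀ {b} → T b → b ≡ true
T⇒≡true {true} _ = refl

¬T⇒≡false : ∀ {b} → ¬ T b → b ≡ false
¬T⇒≡false {false} _ = refl
¬T⇒≡false {true} ¬t = ⊥-elim (¬t tt)

∧≡true : ∀ {a b} → a ∧ b ≡ true → (a ≡ true) × (b ≡ true)
∧≡true {true} {true} _ = refl , refl

≤⇒≤ᵇ≡true : ∀ {m n} → m ≤ n → (m ≤ᵇ n) ≡ true
≤⇒≤ᵇ≡true m≤n = T⇒≡true (ℕₚ.≤⇒≤ᵇ m≤n)

>⇒≤ᵇ≡false : ∀ {m n} → n < m → (m ≤ᵇ n) ≡ false
>⇒≤ᵇ≡false {m} {n} n<m = ¬T⇒≡false (λ t → ℕₚ.<⇒≱ n<m (ℕₚ.≤ᵇ⇒≤ m n t))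

<⇒<ᵇ≡true : ∀ {m n} → m < n → (m <ᵇ n) ≡ true
<⇒<ᵇ≡true m<n = T⇒≡true (ℕₚ.<⇒<ᵇ m<n)

≥⇒<ᵇ≡false : ∀ {m n} → n ≤ m → (m <ᵇ n) ≡ false
≥⇒<ᵇ≡false {m} {n} n≤m = ¬T⇒≡false (λ t → ℕₚ.<⇒≱ (ℕₚ.<ᵇ⇒< m n t) n≤m)

if-true : ∀ {b} (x y : A) → b ≡ true → (if b then x else y) ≡ x
if-true x y refl = refl

if-false : ∀ {b} (x y : A) → b ≡ false → (if b then x else y) ≡ y
if-false x y refl = refl

countᵇ-∷ : (p : A → Bool) (x : A) (xs : List A) → countᵇ p (x ∷ xs) ≡ [ p x ]ᵇ + countᵇ p xs
countᵇ-∷ p x xs with p x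
... | true = refl
... | false = refl

countᵇ-++ : (p : A → Bool) (xs ys : List A) → countᵇ p (xs ++ ys) ≡ countᵇ p xs + countᵇ p ys
countᵇ-++ p [] ys = refl
countᵇ-++ p (x ∷ xs) ys = begin
  countᵇ p (x ∷ xs ++ ys)                ≡⟨ countᵇ-∷ p x (xs ++ ys) ⟩
  [ p x ]ᵇ + countᵇ p (xs ++ ys)         ≡⟨ cong (_+_ [ p x ]ᵇ) (countᵇ-++ p xs ys) ⟩
  [ p x ]ᵇ + (countᵇ p xs + countᵇ p ys) ≡⟨ ℕₚ.+-assoc [ p x ]ᵇ _ _ ⟨
  [ p x ]ᵇ + countᵇ p xs + countᵇ p ys   ≡⟨ cong (_+ countᵇ p ys) (countᵇ-∷ p x xs) ⟨
  countᵇ p (x ∷ xs) + countᵇ p ys        ∎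
  where open ≡-Reasoning

countᵇ≡sum : (p : A → Bool) (xs : List A) → countᵇ p xs ≡ sum (map ([_]ᵇ ∘ p) xs)
countᵇ≡sum p [] = refl
countᵇ≡sum p (x ∷ xs) = trans (countᵇ-∷ p x xs) (cong (_+_ [ p x ]ᵇ) (countᵇ≡sum p xs))

countᵇ-map : (p : B → Bool) (f : A → B) (xs : List A) → countᵇ p (map f xs) ≡ countᵇ (p ∘ f) xs
countᵇ-map p f [] = refl
countᵇ-map p f (x ∷ xs) =
  trans (countᵇ-∷ p (f x) (map f xs))
        (trans (cong (_+_ [ p (f x) ]ᵇ) (countᵇ-map p f xs)) (sym (countᵇ-∷ (p ∘ f) x xs)))

countᵇ-congᴬ : {p q : A → Bool} (xs : List A) → All (λ x → p x ≡ q x) xs → countᵇ p xs ≡ countᵇ q xs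
countᵇ-congᴬ {p = p} {q} xs p≡q = begin
  countᵇ p xs             ≡⟨ countᵇ≡sum p xs ⟩
  sum (map ([_]ᵇ ∘ p) xs) ≡⟨ cong sum (Listₚ.map-cong-local (All.map (cong [_]ᵇ) p≡q)) ⟩
  sum (map ([_]ᵇ ∘ q) xs) ≡⟨ countᵇ≡sum q xs ⟨
  countᵇ q xs             ∎
  where open ≡-Reasoning

countᵇ-const : (b : Bool) (xs : List A) → countᵇ (λ _ → b) xs ≡ [ b ]ᵇ * length xs
countᵇ-const b [] = sym (ℕₚ.*-zeroʳ [ b ]ᵇ)
countᵇ-const b (x ∷ xs) =
  trans (countᵇ-∷ (λ _ → b) x xs)
        (trans (cong (_+_ [ b ]ᵇ) (countᵇ-const b xs)) (sym (ℕₚ.*-suc [ b ]ᵇ (length xs))))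

countᵇ-false : (xs : List A) → countᵇ (λ _ → false) xs ≡ 0
countᵇ-false xs = countᵇ-const false xs

countᵇ-[-] : (p : A → Bool) (x : A) → countᵇ p (x ∷ []) ≡ [ p x ]ᵇ
countᵇ-[-] p x = trans (countᵇ-∷ p x []) (ℕₚ.+-identityʳ [ p x ]ᵇ)

countᵇ-concatMap : (p : B → Bool) (f : A → List B) (xs : List A) →
  countᵇ p (concatMap f xs) ≡ sum (map (countᵇ p ∘ f) xs)
countᵇ-concatMap p f [] = refl
countᵇ-concatMap p f (x ∷ xs) =
  trans (countᵇ-++ p (f x) (concatMap f xs)) (cong (_+_ (countᵇ p (f x))) (countᵇ-concatMap p f xs))

sum-map-+ : (f g : A → ℕ) (xs : List A) → sum (map (λ x → f x + g x) xs) ≡ sum (map f xs) + sum (map g xs)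
sum-map-+ f g [] = refl
sum-map-+ f g (x ∷ xs) =
  trans (cong (_+_ (f x + g x)) (sum-map-+ f g xs)) (+-interchange (f x) (g x) (sum (map f xs)) (sum (map g xs)))

sum-map-* : (c : ℕ) (f : A → ℕ) (xs : List A) → sum (map (λ x → c * f x) xs) ≡ c * sum (map f xs)
sum-map-* c f [] = sym (ℕₚ.*-zeroʳ c)
sum-map-* c f (x ∷ xs) =
  trans (cong (_+_ (c * f x)) (sum-map-* c f xs)) (sym (ℕₚ.*-distribˡ-+ c (f x) (sum (map f xs))))

sum-map-zero : (xs : List A) → sum (map (λ _ → 0) xs) ≡ 0
sum-map-zero [] = refl
sum-map-zero (x ∷ xs) = sum-map-zero xs

sum-map-congᴬ : {f g : A → ℕ} (xs : List A) → All (λ x → f x ≡ g x) xs → sum (map f xs) ≡ sum (map g xs)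
sum-map-congᴬ xs f≡g = cong sum (Listₚ.map-cong-local f≡g)

allᵇ-++ : (p : A → Bool) (xs ys : List A) → allᵇ p (xs ++ ys) ≡ allᵇ p xs ∧ allᵇ p ys
allᵇ-++ p [] ys = refl
allᵇ-++ p (x ∷ xs) ys = trans (cong (p x ∧_) (allᵇ-++ p xs ys)) (sym (Boolₚ.∧-assoc (p x) (allᵇ p xs) (allᵇ p ys)))

allᵇ⇒All : (p : A → Bool) (xs : List A) → allᵇ p xs ≡ true → All (λ x → p x ≡ true) xs
allᵇ⇒All p [] _ = []
allᵇ⇒All p (x ∷ xs) e = proj₁ (∧≡true e) ∷ allᵇ⇒All p xs (proj₂ (∧≡true {p x} e))

hasBlocks : (List ℕ → Bool) → ℕ → List (List ℕ) → Bool
hasBlocks B K P = (length P ≡ᵇ K) ∧ allᵇ B P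

below : (ℕ → ℕ) → ℕ → ℕ
below f zero = 0
below f (suc K) = f K

withNewBlock : ℕ → List (List ℕ) → List (List ℕ)
withNewBlock x P = P ++ (x ∷ []) ∷ []

[hasBlocks-∷] : ∀ B K b P → [ hasBlocks B (suc K) (b ∷ P) ]ᵇ ≡ [ B b ]ᵇ * [ hasBlocks B K P ]ᵇ
[hasBlocks-∷] B K b P with length P ≡ᵇ K
... | true = [∧]ᵇ (B b) (allᵇ B P)
... | false = sym (ℕₚ.*-zeroʳ [ B b ]ᵇ)

countᵇ-hasBlocks-∷ : ∀ B K b (Ps : List (List (List ℕ))) →
  countᵇ (hasBlocks B (suc K) ∘ (b ∷_)) Ps ≡ [ B b ]ᵇ * countᵇ (hasBlocks B K) Ps
countᵇ-hasBlocks-∷ B K b Ps = begin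
  countᵇ (hasBlocks B (suc K) ∘ (b ∷_)) Ps                ≡⟨ countᵇ≡sum _ Ps ⟩
  sum (map (λ P → [ hasBlocks B (suc K) (b ∷ P) ]ᵇ) Ps)  ≡⟨ cong sum (Listₚ.map-cong ([hasBlocks-∷] B K b) Ps) ⟩
  sum (map (λ P → [ B b ]ᵇ * [ hasBlocks B K P ]ᵇ) Ps)   ≡⟨ sum-map-* [ B b ]ᵇ _ Ps ⟩
  [ B b ]ᵇ * sum (map ([_]ᵇ ∘ hasBlocks B K) Ps)          ≡⟨ cong (_*_ [ B b ]ᵇ) (countᵇ≡sum _ Ps) ⟨
  [ B b ]ᵇ * countᵇ (hasBlocks B K) Ps                    ∎
  where open ≡-Reasoning

length-withNewBlock : ∀ x P → length (withNewBlock x P) ≡ suc (length P)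
length-withNewBlock x P = trans (Listₚ.length-++ P) (ℕₚ.+-comm (length P) 1)

[hasBlocks-withNewBlock] : ∀ B x K P → B (x ∷ []) ≡ true →
  [ hasBlocks B K (withNewBlock x P) ]ᵇ ≡ below (λ K → [ hasBlocks B K P ]ᵇ) K
[hasBlocks-withNewBlock] B x K P Bx = begin
  [ (length (withNewBlock x P) ≡ᵇ K) ∧ allᵇ B (withNewBlock x P) ]ᵇ
    ≡⟨ cong₂ (λ l a → [ (l ≡ᵇ K) ∧ a ]ᵇ) (length-withNewBlock x P) allᵇ-withNewBlock ⟩
  [ (suc (length P) ≡ᵇ K) ∧ allᵇ B P ]ᵇ
    ≡⟨ lowered K ⟩
  below (λ K → [ hasBlocks B K P ]ᵇ) K ∎
  where
  open ≡-Reasoning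
  allᵇ-withNewBlock : allᵇ B (withNewBlock x P) ≡ allᵇ B P
  allᵇ-withNewBlock = trans (allᵇ-++ B P ((x ∷ []) ∷ []))
    (trans (cong (λ u → allᵇ B P ∧ (u ∧ true)) Bx) (Boolₚ.∧-identityʳ _))
  lowered : ∀ K → [ (suc (length P) ≡ᵇ K) ∧ allᵇ B P ]ᵇ ≡ below (λ K → [ hasBlocks B K P ]ᵇ) K
  lowered zero = refl
  lowered (suc K) = refl

count-grow : ∀ B (ins : List (List ℕ) → List (List (List ℕ))) x K Ps → B (x ∷ []) ≡ true →
  countᵇ (hasBlocks B K) (concatMap (λ P → ins P ++ withNewBlock x P ∷ []) Ps)
  ≡ sum (map (countᵇ (hasBlocks B K) ∘ ins) Ps) + below (λ K → countᵇ (hasBlocks B K) Ps) K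
count-grow B ins x K Ps Bx = begin
  countᵇ (hasBlocks B K) (concatMap (λ P → ins P ++ withNewBlock x P ∷ []) Ps)
    ≡⟨ countᵇ-concatMap _ _ Ps ⟩
  sum (map (λ P → countᵇ (hasBlocks B K) (ins P ++ withNewBlock x P ∷ [])) Ps)
    ≡⟨ cong sum (Listₚ.map-cong split Ps) ⟩
  sum (map (λ P → countᵇ (hasBlocks B K) (ins P) + [ hasBlocks B K (withNewBlock x P) ]ᵇ) Ps)
    ≡⟨ sum-map-+ _ _ Ps ⟩
  sum (map (countᵇ (hasBlocks B K) ∘ ins) Ps) + sum (map (λ P → [ hasBlocks B K (withNewBlock x P) ]ᵇ) Ps)
    ≡⟨ cong (_+_ (sum (map (countᵇ (hasBlocks B K) ∘ ins) Ps))) newBlock ⟩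
  sum (map (countᵇ (hasBlocks B K) ∘ ins) Ps) + below (λ K → countᵇ (hasBlocks B K) Ps) K
    ∎
  where
  open ≡-Reasoning
  split : ∀ P → countᵇ (hasBlocks B K) (ins P ++ withNewBlock x P ∷ [])
                ≡ countᵇ (hasBlocks B K) (ins P) + [ hasBlocks B K (withNewBlock x P) ]ᵇ
  split P = trans (countᵇ-++ (hasBlocks B K) (ins P) _)
    (cong (_+_ (countᵇ (hasBlocks B K) (ins P))) (countᵇ-[-] (hasBlocks B K) (withNewBlock x P)))
  newBlock : sum (map (λ P → [ hasBlocks B K (withNewBlock x P) ]ᵇ) Ps) ≡ below (λ K → countᵇ (hasBlocks B K) Ps) K
  newBlock = trans (cong sum (Listₚ.map-cong (λ P → [hasBlocks-withNewBlock] B x K P Bx) Ps)) (sum-below K)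
    where
    sum-below : ∀ K → sum (map (λ P → below (λ K → [ hasBlocks B K P ]ᵇ) K) Ps)
                      ≡ below (λ K → countᵇ (hasBlocks B K) Ps) K
    sum-below zero = sum-map-zero Ps
    sum-below (suc K) = sym (countᵇ≡sum (hasBlocks B K) Ps)

count-addToBlock : ∀ B ok x → (∀ b → B (x ∷ b) ≡ B b ∧ ok b) → ∀ K P →
  countᵇ (hasBlocks B K) (addToBlock x P) ≡ [ hasBlocks B K P ]ᵇ * countᵇ ok P
count-addToBlock B ok x B-∷ K [] = sym (ℕₚ.*-zeroʳ [ hasBlocks B K [] ]ᵇ)
count-addToBlock B ok x B-∷ zero (b ∷ bs) =
  trans (countᵇ-map (hasBlocks B zero) (b ∷_) (addToBlock x bs)) (countᵇ-false (addToBlock x bs))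
count-addToBlock B ok x B-∷ (suc K) (b ∷ bs) = begin
  countᵇ (hasBlocks B (suc K)) (((x ∷ b) ∷ bs) ∷ map (b ∷_) (addToBlock x bs))
    ≡⟨ countᵇ-∷ (hasBlocks B (suc K)) ((x ∷ b) ∷ bs) _ ⟩
  [ hasBlocks B (suc K) ((x ∷ b) ∷ bs) ]ᵇ + countᵇ (hasBlocks B (suc K)) (map (b ∷_) (addToBlock x bs))
    ≡⟨ cong₂ _+_ ([hasBlocks-∷] B K (x ∷ b) bs)
                 (trans (countᵇ-map _ (b ∷_) (addToBlock x bs)) (countᵇ-hasBlocks-∷ B K b (addToBlock x bs))) ⟩
  [ B (x ∷ b) ]ᵇ * h + β * countᵇ (hasBlocks B K) (addToBlock x bs)
    ≡⟨ cong₂ (λ u v → u * h + β * v) (trans (cong [_]ᵇ (B-∷ b)) ([∧]ᵇ (B b) (ok b)))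
                                      (count-addToBlock B ok x B-∷ K bs) ⟩
  β * [ ok b ]ᵇ * h + β * (h * countᵇ ok bs)
    ≡⟨ factor β [ ok b ]ᵇ h (countᵇ ok bs) ⟩
  β * h * ([ ok b ]ᵇ + countᵇ ok bs)
    ≡⟨ cong₂ _*_ ([hasBlocks-∷] B K b bs) (countᵇ-∷ ok b bs) ⟨
  [ hasBlocks B (suc K) (b ∷ bs) ]ᵇ * countᵇ ok (b ∷ bs) ∎
  where
  open ≡-Reasoning
  β h : ℕ
  β = [ B b ]ᵇ
  h = [ hasBlocks B K bs ]ᵇ
  factor : ∀ β o h n → β * o * h + β * (h * n) ≡ β * h * (o + n)
  factor = solve-∀

-- Blocks meeting each interval at most once

inInterval : ℕ → ℕ → ℕ → Bool
inInterval lo hi x = (suc lo ≤ᵇ x) ∧ (x ≤ᵇ hi)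

insertOK : List Pair → ℕ → List ℕ → Bool
insertOK Is x b = allᵇ (λ { ⟨ lo , hi ⟩ → not (inInterval lo hi x) ∨ (countIn lo hi b ≡ᵇ 0) }) Is


[]ᵇ+-≤ᵇ1 : ∀ i c → ([ i ]ᵇ + c ≤ᵇ 1) ≡ (c ≤ᵇ 1) ∧ (not i ∨ (c ≡ᵇ 0))
[]ᵇ+-≤ᵇ1 true zero = refl
[]ᵇ+-≤ᵇ1 true (suc c) = sym (Boolₚ.∧-zeroʳ _)
[]ᵇ+-≤ᵇ1 false c = sym (Boolₚ.∧-identityʳ _)

[]ᵇ+0≤ᵇ1 : ∀ i → ([ i ]ᵇ + 0 ≤ᵇ 1) ≡ true
[]ᵇ+0≤ᵇ1 true = refl
[]ᵇ+0≤ᵇ1 false = refl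

blockOK-∷ : ∀ Is x b → blockOK Is (x ∷ b) ≡ blockOK Is b ∧ insertOK Is x b
blockOK-∷ [] x b = refl
blockOK-∷ (⟨ lo , hi ⟩ ∷ Is) x b =
  trans (cong₂ _∧_ ([]ᵇ+-≤ᵇ1 (inInterval lo hi x) (countIn lo hi b)) (blockOK-∷ Is x b))
        (∧-interchange (countIn lo hi b ≤ᵇ 1) _ (blockOK Is b) (insertOK Is x b))

blockOK-singleton : ∀ Is x → blockOK Is (x ∷ []) ≡ true
blockOK-singleton [] x = refl
blockOK-singleton (⟨ lo , hi ⟩ ∷ Is) x = cong₂ _∧_ (([]ᵇ+0≤ᵇ1 (inInterval lo hi x))) (blockOK-singleton Is x)

countInBlocks : ℕ → ℕ → List (List ℕ) → ℕ
countInBlocks lo hi P = sum (map (countIn lo hi) P)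

Covers : ℕ → List (List ℕ) → Set
Covers N P = ∀ lo hi → countInBlocks lo hi P ≡ countIn lo hi (applyDownFrom suc N)

countInBlocks-addToBlock : ∀ x P →
  All (λ Q → ∀ lo hi → countInBlocks lo hi Q ≡ [ inInterval lo hi x ]ᵇ + countInBlocks lo hi P) (addToBlock x P)
countInBlocks-addToBlock x [] = []
countInBlocks-addToBlock x (b ∷ bs) =
  (λ lo hi → ℕₚ.+-assoc [ inInterval lo hi x ]ᵇ (countIn lo hi b) (countInBlocks lo hi bs))
  ∷ Allₚ.map⁺ (All.map (λ {Q} eq lo hi → trans (cong (_+_ (countIn lo hi b)) (eq lo hi)) (swap lo hi))
                       (countInBlocks-addToBlock x bs))
  where
  swap : ∀ lo hi → countIn lo hi b + ([ inInterval lo hi x ]ᵇ + countInBlocks lo hi bs)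
                   ≡ [ inInterval lo hi x ]ᵇ + (countIn lo hi b + countInBlocks lo hi bs)
  swap lo hi = +-left-comm (countIn lo hi b) [ inInterval lo hi x ]ᵇ (countInBlocks lo hi bs)

countInBlocks-withNewBlock : ∀ lo hi x P →
  countInBlocks lo hi (withNewBlock x P) ≡ [ inInterval lo hi x ]ᵇ + countInBlocks lo hi P
countInBlocks-withNewBlock lo hi x [] = ℕₚ.+-identityʳ _
countInBlocks-withNewBlock lo hi x (b ∷ P) =
  trans (cong (_+_ (countIn lo hi b)) (countInBlocks-withNewBlock lo hi x P))
        (+-left-comm (countIn lo hi b) [ inInterval lo hi x ]ᵇ (countInBlocks lo hi P))

setPartitions-covers : ∀ N → All (Covers N) (setPartitions N)
setPartitions-covers zero = (λ lo hi → refl) ∷ []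
setPartitions-covers (suc N) = Allₚ.concat⁺ (Allₚ.map⁺ (All.map grown (setPartitions-covers N)))
  where
  grown : ∀ {P} → Covers N P → All (Covers (suc N)) (addToBlock (suc N) P ++ withNewBlock (suc N) P ∷ [])
  grown {P} cov = Allₚ.++⁺
    (All.map (λ {Q} eq lo hi → trans (eq lo hi) (cong (_+_ [ inInterval lo hi (suc N) ]ᵇ) (cov lo hi)))
             (countInBlocks-addToBlock (suc N) P))
    ((λ lo hi → trans (countInBlocks-withNewBlock lo hi (suc N) P)
                      (cong (_+_ [ inInterval lo hi (suc N) ]ᵇ) (cov lo hi))) ∷ [])

countIn-upTo-below : ∀ lo hi N → N ≤ lo → countIn lo hi (applyDownFrom suc N) ≡ 0
countIn-upTo-below lo hi zero N≤lo = refl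
countIn-upTo-below lo hi (suc N) N<lo =
  cong₂ _+_ (cong [_]ᵇ (cong (_∧ (suc N ≤ᵇ hi)) (>⇒≤ᵇ≡false (s≤s N<lo))))
            (countIn-upTo-below lo hi N (ℕₚ.<⇒≤ N<lo))

countIn-upTo-inside : ∀ lo hi N → lo ≤ N → N ≤ hi → countIn lo hi (applyDownFrom suc N) ≡ N ∸ lo
countIn-upTo-inside lo hi N lo≤N N≤hi with ℕₚ.m≤n⇒m<n∨m≡n lo≤N
countIn-upTo-inside lo hi N lo≤N N≤hi | inj₂ refl = trans (countIn-upTo-below lo hi N ℕₚ.≤-refl) (sym (ℕₚ.n∸n≡0 N))
countIn-upTo-inside lo hi (suc N) lo≤N N≤hi | inj₁ (s≤s lo≤N′) = begin
  [ inInterval lo hi (suc N) ]ᵇ + countIn lo hi (applyDownFrom suc N)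
    ≡⟨ cong₂ _+_ (cong [_]ᵇ (cong₂ _∧_ (≤⇒≤ᵇ≡true (s≤s lo≤N′)) (≤⇒≤ᵇ≡true N≤hi)))
                 (countIn-upTo-inside lo hi N lo≤N′ (ℕₚ.<⇒≤ N≤hi)) ⟩
  1 + (N ∸ lo) ≡⟨ ℕₚ.+-∸-assoc 1 lo≤N′ ⟨
  suc N ∸ lo   ∎
  where open ≡-Reasoning

missing+countInBlocks≡length : ∀ lo hi P → All (λ b → countIn lo hi b ≤ 1) P →
  countᵇ (λ b → countIn lo hi b ≡ᵇ 0) P + countInBlocks lo hi P ≡ length P
missing+countInBlocks≡length lo hi [] [] = refl
missing+countInBlocks≡length lo hi (b ∷ P) (b≤1 ∷ P≤1) = begin
  countᵇ missing (b ∷ P) + (c + countInBlocks lo hi P)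
    ≡⟨ cong (_+ (c + countInBlocks lo hi P)) (countᵇ-∷ missing b P) ⟩
  [ c ≡ᵇ 0 ]ᵇ + countᵇ missing P + (c + countInBlocks lo hi P)
    ≡⟨ +-interchange [ c ≡ᵇ 0 ]ᵇ (countᵇ missing P) c (countInBlocks lo hi P) ⟩
  ([ c ≡ᵇ 0 ]ᵇ + c) + (countᵇ missing P + countInBlocks lo hi P)
    ≡⟨ cong₂ _+_ (once c b≤1) (missing+countInBlocks≡length lo hi P P≤1) ⟩
  suc (length P) ∎
  where
  open ≡-Reasoning
  missing : List ℕ → Bool
  missing b′ = countIn lo hi b′ ≡ᵇ 0
  c : ℕ
  c = countIn lo hi b
  once : ∀ c → c ≤ 1 → [ c ≡ᵇ 0 ]ᵇ + c ≡ 1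
  once zero _ = refl
  once (suc zero) _ = refl
  once (suc (suc c)) (s≤s ())

-- rank s N: the number of elements of the interval containing N + 1 that precede
-- N + 1 (0 when N + 1 lies beyond all intervals)
rank : List ℕ → ℕ → ℕ
rank [] N = 0
rank (a ∷ s) N = if N <ᵇ a then N else rank s (N ∸ a)

insertOK-beyond : ∀ off s x b → x ≤ off → insertOK (intervals off s) x b ≡ true
insertOK-beyond off [] x b x≤off = refl
insertOK-beyond off (a ∷ s) x b x≤off =
  cong₂ (λ i r → (not (i ∧ (x ≤ᵇ off + a)) ∨ (countIn off (off + a) b ≡ᵇ 0)) ∧ r)
        (>⇒≤ᵇ≡false (s≤s x≤off)) (insertOK-beyond (off + a) s x b (ℕₚ.≤-trans x≤off (ℕₚ.m≤m+n off a)))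

count-insertOK : ∀ s off N P → off ≤ N → All (λ b → blockOK (intervals off s) b ≡ true) P → Covers N P →
  countᵇ (insertOK (intervals off s) (suc N)) P + rank s (N ∸ off) ≡ length P
count-insertOK [] off N P _ _ _ = trans (ℕₚ.+-identityʳ _) (trans (countᵇ-const true P) (ℕₚ.*-identityˡ _))
count-insertOK (a ∷ s) off N P off≤N valid cov with (N ∸ off) ℕ.<? a
... | yes inside = begin
  countᵇ (insertOK (intervals off (a ∷ s)) (suc N)) P + rank (a ∷ s) (N ∸ off)
    ≡⟨ cong₂ _+_ (countᵇ-congᴬ P (All.universal insertOK-inside P)) (if-true _ _ (<⇒<ᵇ≡true inside)) ⟩
  countᵇ missing P + (N ∸ off)
    ≡⟨ cong (_+_ (countᵇ missing P))
            (sym (trans (cov off (off + a)) (countIn-upTo-inside off (off + a) N off≤N (ℕₚ.<⇒≤ N<hi)))) ⟩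
  countᵇ missing P + countInBlocks off (off + a) P
    ≡⟨ missing+countInBlocks≡length off (off + a) P (All.map meetsOnce valid) ⟩
  length P ∎
  where
  open ≡-Reasoning
  missing : List ℕ → Bool
  missing b′ = countIn off (off + a) b′ ≡ᵇ 0
  N<hi : suc N ≤ off + a
  N<hi = subst (_≤ off + a) (trans (ℕₚ.+-suc off (N ∸ off)) (cong suc (ℕₚ.m+[n∸m]≡n off≤N)))
               (ℕₚ.+-monoʳ-≤ off inside)
  insertOK-inside : ∀ b → insertOK (intervals off (a ∷ s)) (suc N) b ≡ missing b
  insertOK-inside b = trans (cong₂ (λ i r → (not i ∨ missing b) ∧ r)
                                   (cong₂ _∧_ (≤⇒≤ᵇ≡true (s≤s off≤N)) (≤⇒≤ᵇ≡true N<hi))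
                                   (insertOK-beyond (off + a) s (suc N) b N<hi))
                            (Boolₚ.∧-identityʳ (missing b))
  meetsOnce : ∀ {b} → blockOK (intervals off (a ∷ s)) b ≡ true → countIn off (off + a) b ≤ 1
  meetsOnce {b} ok = ℕₚ.≤ᵇ⇒≤ (countIn off (off + a) b) 1 (subst T (sym (proj₁ (∧≡true ok))) tt)
... | no beyond = begin
  countᵇ (insertOK (intervals off (a ∷ s)) (suc N)) P + rank (a ∷ s) (N ∸ off)
    ≡⟨ cong₂ _+_ (countᵇ-congᴬ P (All.universal insertOK-beyond-first P))
                 (trans (if-false _ _ (≥⇒<ᵇ≡false (ℕₚ.≮⇒≥ beyond)))
                        (cong (rank s) (ℕₚ.∸-+-assoc N off a))) ⟩
  countᵇ (insertOK (intervals (off + a) s) (suc N)) P + rank s (N ∸ (off + a))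
    ≡⟨ count-insertOK s (off + a) N P hi≤N (All.map (λ ok → proj₂ (∧≡true ok)) valid) cov ⟩
  length P ∎
  where
  open ≡-Reasoning
  hi≤N : off + a ≤ N
  hi≤N = subst (off + a ≤_) (ℕₚ.m+[n∸m]≡n off≤N) (ℕₚ.+-monoʳ-≤ off (ℕₚ.≮⇒≥ beyond))
  outside : inInterval off (off + a) (suc N) ≡ false
  outside = trans (cong ((suc off ≤ᵇ suc N) ∧_) (>⇒≤ᵇ≡false (s≤s hi≤N))) (Boolₚ.∧-zeroʳ _)
  insertOK-beyond-first : ∀ b → insertOK (intervals off (a ∷ s)) (suc N) b ≡ insertOK (intervals (off + a) s) (suc N) b
  insertOK-beyond-first b =
    cong (λ i → (not i ∨ (countIn off (off + a) b ≡ᵇ 0)) ∧ insertOK (intervals (off + a) s) (suc N) b) outside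

stirling2s-suc : ∀ s N K →
  stirling2s (suc N) K s + rank s N * stirling2s N K s ≡ K * stirling2s N K s + below (λ K → stirling2s N K s) K
stirling2s-suc s N K = begin
  countᵇ (hasBlocks valid K) (setPartitions (suc N)) + c * S
    ≡⟨ cong (_+ c * S) (count-grow valid (addToBlock (suc N)) (suc N) K Ps (blockOK-singleton (intervals 0 s) (suc N))) ⟩
  sum (map (countᵇ (hasBlocks valid K) ∘ addToBlock (suc N)) Ps) + S↓ + c * S
    ≡⟨ +-right-comm (sum (map (countᵇ (hasBlocks valid K) ∘ addToBlock (suc N)) Ps)) S↓ (c * S) ⟩
  sum (map (countᵇ (hasBlocks valid K) ∘ addToBlock (suc N)) Ps) + c * S + S↓
    ≡⟨ cong (_+ S↓) insertions ⟩
  K * S + S↓ ∎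
  where
  open ≡-Reasoning
  valid ok : List ℕ → Bool
  valid = blockOK (intervals 0 s)
  ok = insertOK (intervals 0 s) (suc N)
  Ps : List (List (List ℕ))
  Ps = setPartitions N
  c S S↓ : ℕ
  c = rank s N
  S = stirling2s N K s
  S↓ = below (λ K → stirling2s N K s) K
  h : List (List ℕ) → ℕ
  h P = [ hasBlocks valid K P ]ᵇ
  perPartition : ∀ P → Covers N P → h P * countᵇ ok P + c * h P ≡ K * h P
  perPartition P cov with hasBlocks valid K P in eq
  ... | false = trans (ℕₚ.*-zeroʳ c) (sym (ℕₚ.*-zeroʳ K))
  ... | true = begin
    1 * countᵇ ok P + c * 1 ≡⟨ cong₂ _+_ (ℕₚ.*-identityˡ _) (ℕₚ.*-identityʳ c) ⟩
    countᵇ ok P + c         ≡⟨ count-insertOK s 0 N P z≤n (allᵇ⇒All valid P (proj₂ (∧≡true eq))) cov ⟩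
    length P                ≡⟨ ℕₚ.≡ᵇ⇒≡ (length P) K (subst T (sym (proj₁ (∧≡true eq))) tt) ⟩
    K                       ≡⟨ ℕₚ.*-identityʳ K ⟨
    K * 1                   ∎
  insertions : sum (map (countᵇ (hasBlocks valid K) ∘ addToBlock (suc N)) Ps) + c * S ≡ K * S
  insertions = begin
    sum (map (countᵇ (hasBlocks valid K) ∘ addToBlock (suc N)) Ps) + c * S
      ≡⟨ cong₂ (λ u v → u + c * v)
               (cong sum (Listₚ.map-cong (count-addToBlock valid ok (suc N) (blockOK-∷ (intervals 0 s) (suc N)) K) Ps))
               (countᵇ≡sum (hasBlocks valid K) Ps) ⟩
    sum (map (λ P → h P * countᵇ ok P) Ps) + c * sum (map h Ps)
      ≡⟨ cong (_+_ (sum (map (λ P → h P * countᵇ ok P) Ps))) (sum-map-* c h Ps) ⟨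
    sum (map (λ P → h P * countᵇ ok P) Ps) + sum (map (λ P → c * h P) Ps)
      ≡⟨ sum-map-+ (λ P → h P * countᵇ ok P) (λ P → c * h P) Ps ⟨
    sum (map (λ P → h P * countᵇ ok P + c * h P) Ps)
      ≡⟨ sum-map-congᴬ Ps (All.map (λ {P} → perPartition P) (setPartitions-covers N)) ⟩
    sum (map (λ P → K * h P) Ps)
      ≡⟨ sum-map-* K h Ps ⟩
    K * sum (map h Ps)
      ≡⟨ cong (K *_) (countᵇ≡sum (hasBlocks valid K) Ps) ⟨
    K * S ∎

-- Permutations with 1, …, r in distinct cycles

separated : ℕ → List ℕ → Bool
separated r c = countIn 0 r c ≤ᵇ 1

totalLength : List (List ℕ) → ℕ
totalLength C = sum (map length C)

countIn-insertAfterEach : ∀ lo hi x c →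
  All (λ c′ → countIn lo hi c′ ≡ [ inInterval lo hi x ]ᵇ + countIn lo hi c) (insertAfterEach x c)
countIn-insertAfterEach lo hi x [] = []
countIn-insertAfterEach lo hi x (a ∷ as) =
  +-left-comm [ inInterval lo hi a ]ᵇ [ inInterval lo hi x ]ᵇ (countIn lo hi as)
  ∷ Allₚ.map⁺ (All.map (λ {c′} eq → trans (cong (_+_ [ inInterval lo hi a ]ᵇ) eq)
                                          (+-left-comm [ inInterval lo hi a ]ᵇ [ inInterval lo hi x ]ᵇ (countIn lo hi as)))
                       (countIn-insertAfterEach lo hi x as))

length-insertAfterEach-elements : ∀ x c → All (λ c′ → length c′ ≡ suc (length c)) (insertAfterEach x c)
length-insertAfterEach-elements x [] = []
length-insertAfterEach-elements x (a ∷ as) =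
  refl ∷ Allₚ.map⁺ (All.map (cong suc) (length-insertAfterEach-elements x as))

length-insertAfterEach : ∀ x c → length (insertAfterEach x c) ≡ length c
length-insertAfterEach x [] = refl
length-insertAfterEach x (a ∷ as) =
  cong suc (trans (Listₚ.length-map (a ∷_) (insertAfterEach x as)) (length-insertAfterEach x as))

totalLength-addToCycle : ∀ x C → All (λ C′ → totalLength C′ ≡ suc (totalLength C)) (addToCycle x C)
totalLength-addToCycle x [] = []
totalLength-addToCycle x (c ∷ cs) = Allₚ.++⁺
  (Allₚ.map⁺ (All.map (cong (_+ totalLength cs)) (length-insertAfterEach-elements x c)))
  (Allₚ.map⁺ (All.map (λ {C′} eq → trans (cong (_+_ (length c)) eq) (ℕₚ.+-suc (length c) (totalLength cs)))
                      (totalLength-addToCycle x cs)))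

totalLength-withNewBlock : ∀ x C → totalLength (withNewBlock x C) ≡ suc (totalLength C)
totalLength-withNewBlock x [] = refl
totalLength-withNewBlock x (c ∷ C) =
  trans (cong (_+_ (length c)) (totalLength-withNewBlock x C)) (ℕₚ.+-suc (length c) (totalLength C))

permutationsCyc-totalLength : ∀ N → All (λ C → totalLength C ≡ N) (permutationsCyc N)
permutationsCyc-totalLength zero = refl ∷ []
permutationsCyc-totalLength (suc N) = Allₚ.concat⁺ (Allₚ.map⁺ (All.map grown (permutationsCyc-totalLength N)))
  where
  grown : ∀ {C} → totalLength C ≡ N →
          All (λ C′ → totalLength C′ ≡ suc N) (addToCycle (suc N) C ++ withNewBlock (suc N) C ∷ [])
  grown {C} eq = Allₚ.++⁺ (All.map (λ eq′ → trans eq′ (cong suc eq)) (totalLength-addToCycle (suc N) C))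
                          (trans (totalLength-withNewBlock (suc N) C) (cong suc eq) ∷ [])

-- while N ≤ r, every element is among 1, …, r, so every cycle meets {1, …, r}
permutationsCyc-meet : ∀ r N → N ≤ r → All (All (λ c → 1 ≤ countIn 0 r c)) (permutationsCyc N)
permutationsCyc-meet r zero _ = [] ∷ []
permutationsCyc-meet r (suc N) N<r =
  Allₚ.concat⁺ (Allₚ.map⁺ (All.map grown (permutationsCyc-meet r N (ℕₚ.<⇒≤ N<r))))
  where
  inside : [ inInterval 0 r (suc N) ]ᵇ ≡ 1
  inside = cong [_]ᵇ (≤⇒≤ᵇ≡true N<r)
  grown : ∀ {C} → All (λ c → 1 ≤ countIn 0 r c) C →
          All (All (λ c → 1 ≤ countIn 0 r c)) (addToCycle (suc N) C ++ withNewBlock (suc N) C ∷ [])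
  grown {C} meets =
    Allₚ.++⁺ (inserted C meets) (Allₚ.++⁺ meets (subst (1 ≤_) (sym (cong (_+ 0) inside)) ℕₚ.≤-refl ∷ []) ∷ [])
    where
    inserted : ∀ C → All (λ c → 1 ≤ countIn 0 r c) C → All (All (λ c → 1 ≤ countIn 0 r c)) (addToCycle (suc N) C)
    inserted [] [] = []
    inserted (c ∷ cs) (m ∷ ms) = Allₚ.++⁺
      (Allₚ.map⁺ (All.map (λ {c′} eq → subst (1 ≤_) (sym (trans eq (cong (_+ countIn 0 r c) inside))) (s≤s z≤n) ∷ ms)
                          (countIn-insertAfterEach 0 r (suc N) c)))
      (Allₚ.map⁺ (All.map (m ∷_) (inserted cs ms)))

count-addToCycle-outside : ∀ r x K C → inInterval 0 r x ≡ false →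
  countᵇ (hasBlocks (separated r) K) (addToCycle x C) ≡ [ hasBlocks (separated r) K C ]ᵇ * totalLength C
count-addToCycle-outside r x K [] _ = sym (ℕₚ.*-zeroʳ [ hasBlocks (separated r) K [] ]ᵇ)
count-addToCycle-outside r x zero (c ∷ cs) _ =
  trans (countᵇ-++ (hasBlocks (separated r) zero) (map (_∷ cs) (insertAfterEach x c)) _)
        (cong₂ _+_ (trans (countᵇ-map _ (_∷ cs) (insertAfterEach x c)) (countᵇ-false (insertAfterEach x c)))
                   (trans (countᵇ-map _ (c ∷_) (addToCycle x cs)) (countᵇ-false (addToCycle x cs))))
count-addToCycle-outside r x (suc K) (c ∷ cs) outside = begin
  countᵇ hB (map (_∷ cs) (insertAfterEach x c) ++ map (c ∷_) (addToCycle x cs))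
    ≡⟨ countᵇ-++ hB (map (_∷ cs) (insertAfterEach x c)) _ ⟩
  countᵇ hB (map (_∷ cs) (insertAfterEach x c)) + countᵇ hB (map (c ∷_) (addToCycle x cs))
    ≡⟨ cong₂ _+_ (countᵇ-map hB (_∷ cs) (insertAfterEach x c)) (countᵇ-map hB (c ∷_) (addToCycle x cs)) ⟩
  countᵇ (hB ∘ (_∷ cs)) (insertAfterEach x c) + countᵇ (hB ∘ (c ∷_)) (addToCycle x cs)
    ≡⟨ cong₂ _+_ intoFirst (countᵇ-hasBlocks-∷ (separated r) K c (addToCycle x cs)) ⟩
  h * length c + [ separated r c ]ᵇ * countᵇ (hasBlocks (separated r) K) (addToCycle x cs)
    ≡⟨ cong (λ n → h * length c + [ separated r c ]ᵇ * n) (count-addToCycle-outside r x K cs outside) ⟩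
  h * length c + [ separated r c ]ᵇ * ([ hasBlocks (separated r) K cs ]ᵇ * totalLength cs)
    ≡⟨ cong (_+_ (h * length c)) (trans (cong (_* totalLength cs) ([hasBlocks-∷] (separated r) K c cs))
                                        (ℕₚ.*-assoc [ separated r c ]ᵇ _ (totalLength cs))) ⟨
  h * length c + h * totalLength cs
    ≡⟨ ℕₚ.*-distribˡ-+ h (length c) (totalLength cs) ⟨
  h * totalLength (c ∷ cs) ∎
  where
  open ≡-Reasoning
  hB : List (List ℕ) → Bool
  hB = hasBlocks (separated r) (suc K)
  h : ℕ
  h = [ hB (c ∷ cs) ]ᵇ
  intoFirst : countᵇ (hB ∘ (_∷ cs)) (insertAfterEach x c) ≡ h * length c
  intoFirst = begin
    countᵇ (hB ∘ (_∷ cs)) (insertAfterEach x c)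
      ≡⟨ countᵇ-congᴬ (insertAfterEach x c)
           (All.map (λ {c′} eq → cong (λ n → (length cs ≡ᵇ K) ∧ ((n ≤ᵇ 1) ∧ allᵇ (separated r) cs))
                                      (trans eq (cong (λ i → [ i ]ᵇ + countIn 0 r c) outside)))
                    (countIn-insertAfterEach 0 r x c)) ⟩
    countᵇ (λ _ → hB (c ∷ cs)) (insertAfterEach x c)
      ≡⟨ countᵇ-const (hB (c ∷ cs)) (insertAfterEach x c) ⟩
    h * length (insertAfterEach x c)
      ≡⟨ cong (h *_) (length-insertAfterEach x c) ⟩
    h * length c ∎

count-addToCycle-inside : ∀ r x K C → inInterval 0 r x ≡ true → All (λ c → 1 ≤ countIn 0 r c) C →
  countᵇ (hasBlocks (separated r) K) (addToCycle x C) ≡ 0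
count-addToCycle-inside r x K C inside meets =
  trans (countᵇ-congᴬ (addToCycle x C) (All.map (λ {C′} → rejected C′) (notSeparated C meets)))
        (countᵇ-false (addToCycle x C))
  where
  rejected : ∀ C′ → allᵇ (separated r) C′ ≡ false → hasBlocks (separated r) K C′ ≡ false
  rejected C′ ns = trans (cong ((length C′ ≡ᵇ K) ∧_) ns) (Boolₚ.∧-zeroʳ (length C′ ≡ᵇ K))
  twice : ∀ {c′} c → 1 ≤ countIn 0 r c → countIn 0 r c′ ≡ [ inInterval 0 r x ]ᵇ + countIn 0 r c →
          separated r c′ ≡ false
  twice c m eq = >⇒≤ᵇ≡false (subst (2 ≤_) (sym (trans eq (cong (_+ countIn 0 r c) (cong [_]ᵇ inside)))) (s≤s m))
  notSeparated : ∀ C → All (λ c → 1 ≤ countIn 0 r c) C →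
                 All (λ C′ → allᵇ (separated r) C′ ≡ false) (addToCycle x C)
  notSeparated [] [] = []
  notSeparated (c ∷ cs) (m ∷ ms) = Allₚ.++⁺
    (Allₚ.map⁺ (All.map (λ {c′} eq → cong (_∧ allᵇ (separated r) cs) (twice {c′} c m eq))
                        (countIn-insertAfterEach 0 r x c)))
    (Allₚ.map⁺ (All.map (λ ns → trans (cong (separated r c ∧_) ns) (Boolₚ.∧-zeroʳ _)) (notSeparated cs ms)))

rStirling1-suc-outside : ∀ r N K → r ≤ N →
  rStirling1 (suc N) K r ≡ N * rStirling1 N K r + below (λ K → rStirling1 N K r) K
rStirling1-suc-outside r N K r≤N = begin
  countᵇ (hasBlocks (separated r) K) (permutationsCyc (suc N))
    ≡⟨ count-grow (separated r) (addToCycle (suc N)) (suc N) K Cs ([]ᵇ+0≤ᵇ1 (inInterval 0 r (suc N))) ⟩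
  sum (map (countᵇ (hasBlocks (separated r) K) ∘ addToCycle (suc N)) Cs) + S↓
    ≡⟨ cong (_+ S↓) (sum-map-congᴬ Cs (All.map (λ {C} → perPermutation C) (permutationsCyc-totalLength N))) ⟩
  sum (map (λ C → N * h C) Cs) + S↓
    ≡⟨ cong (_+ S↓) (trans (sum-map-* N h Cs) (cong (N *_) (sym (countᵇ≡sum (hasBlocks (separated r) K) Cs)))) ⟩
  N * rStirling1 N K r + S↓ ∎
  where
  open ≡-Reasoning
  Cs : List (List (List ℕ))
  Cs = permutationsCyc N
  S↓ : ℕ
  S↓ = below (λ K → rStirling1 N K r) K
  h : List (List ℕ) → ℕ
  h C = [ hasBlocks (separated r) K C ]ᵇ
  outside : inInterval 0 r (suc N) ≡ false
  outside = trans (cong ((1 ≤ᵇ suc N) ∧_) (>⇒≤ᵇ≡false (s≤s r≤N))) (Boolₚ.∧-zeroʳ (1 ≤ᵇ suc N))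
  perPermutation : ∀ C → totalLength C ≡ N → countᵇ (hasBlocks (separated r) K) (addToCycle (suc N) C) ≡ N * h C
  perPermutation C eq =
    trans (count-addToCycle-outside r (suc N) K C outside) (trans (cong (h C *_) eq) (ℕₚ.*-comm (h C) N))

rStirling1-suc-inside : ∀ r N K → N < r → rStirling1 (suc N) K r ≡ below (λ K → rStirling1 N K r) K
rStirling1-suc-inside r N K N<r = begin
  countᵇ (hasBlocks (separated r) K) (permutationsCyc (suc N))
    ≡⟨ count-grow (separated r) (addToCycle (suc N)) (suc N) K Cs ([]ᵇ+0≤ᵇ1 (inInterval 0 r (suc N))) ⟩
  sum (map (countᵇ (hasBlocks (separated r) K) ∘ addToCycle (suc N)) Cs) + S↓
    ≡⟨ cong (_+ S↓) (trans (sum-map-congᴬ Cs (All.map (λ {C} → count-addToCycle-inside r (suc N) K C inside)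
                                                      (permutationsCyc-meet r N (ℕₚ.<⇒≤ N<r))))
                           (sum-map-zero Cs)) ⟩
  S↓ ∎
  where
  open ≡-Reasoning
  Cs : List (List (List ℕ))
  Cs = permutationsCyc N
  S↓ : ℕ
  S↓ = below (λ K → rStirling1 N K r) K
  inside : inInterval 0 r (suc N) ≡ true
  inside = ≤⇒≤ᵇ≡true N<r

rStirling1-above : ∀ r N K → N < K → rStirling1 N K r ≡ 0
rStirling1-above r zero zero ()
rStirling1-above r zero (suc K) _ = refl
rStirling1-above r (suc N) (suc K) (s≤s N<K) with r ℕ.≤? N
... | yes r≤N = trans (rStirling1-suc-outside r N (suc K) r≤N)
                      (cong₂ _+_ (trans (cong (N *_) (rStirling1-above r N (suc K) (ℕₚ.m<n⇒m<1+n N<K))) (ℕₚ.*-zeroʳ N))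
                                 (rStirling1-above r N K N<K))
... | no r≰N = trans (rStirling1-suc-inside r N (suc K) (ℕₚ.≰⇒> r≰N)) (rStirling1-above r N K N<K)

rStirling1-below : ∀ r N K → K < r → K < N → rStirling1 N K r ≡ 0
rStirling1-below r zero K _ ()
rStirling1-below r (suc N) K K<r K<N = byPosition (r ℕ.≤? N)
  where
  lower : ∀ K → K < r → K < suc N → below (λ K → rStirling1 N K r) K ≡ 0
  lower zero _ _ = refl
  lower (suc K) K<r (s≤s K<N) = rStirling1-below r N K (ℕₚ.<-trans (ℕₚ.n<1+n K) K<r) K<N
  byPosition : Dec (r ≤ N) → rStirling1 (suc N) K r ≡ 0
  byPosition (yes r≤N) =
    trans (rStirling1-suc-outside r N K r≤N)
          (cong₂ _+_ (trans (cong (N *_) (rStirling1-below r N K K<r (ℕₚ.<-≤-trans K<r r≤N))) (ℕₚ.*-zeroʳ N))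
                     (lower K K<r K<N))
  byPosition (no r≰N) = trans (rStirling1-suc-inside r N K (ℕₚ.≰⇒> r≰N)) (lower K K<r K<N)

rStirling1-diagonal : ∀ r N → N ≤ r → rStirling1 N N r ≡ 1
rStirling1-diagonal r zero _ = refl
rStirling1-diagonal r (suc N) N<r = trans (rStirling1-suc-inside r N (suc N) N<r) (rStirling1-diagonal r N (ℕₚ.<⇒≤ N<r))

-- Operators on coefficient sequences

infixr 30 z·_

z·_ : Poly → Poly
(z· g) zero = + 0
(z· g) (suc K) = g K

U : ℕ → Poly → Poly
U c g K = (+ K ℤ.- + c) ℤ.* g K ℤ.+ (z· g) K

U⋆ : List ℕ → Poly → Poly
U⋆ cs g = foldr U g cs

z·-cong : ∀ {g h} → g ≈ₚ h → z· g ≈ₚ z· h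
z·-cong g≈h zero = refl
z·-cong g≈h (suc K) = g≈h K

z·-+ : ∀ g h → z· (g +ₚ h) ≈ₚ (z· g +ₚ z· h)
z·-+ g h zero = refl
z·-+ g h (suc K) = refl

z·-· : ∀ a g → z· (a ·ₚ g) ≈ₚ (a ·ₚ z· g)
z·-· a g zero = sym (ℤₚ.*-zeroʳ a)
z·-· a g (suc K) = refl

U-cong : ∀ c {g h} → g ≈ₚ h → U c g ≈ₚ U c h
U-cong c g≈h K = cong₂ (λ u v → (+ K ℤ.- + c) ℤ.* u ℤ.+ v) (g≈h K) (z·-cong g≈h K)

U-+ : ∀ c g h → U c (g +ₚ h) ≈ₚ (U c g +ₚ U c h)
U-+ c g h K = trans (cong (ℤ._+_ ((+ K ℤ.- + c) ℤ.* (g K ℤ.+ h K))) (z·-+ g h K))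
                    (distrib (+ K ℤ.- + c) (g K) (h K) ((z· g) K) ((z· h) K))
  where
  distrib : ∀ k x y p q → k ℤ.* (x ℤ.+ y) ℤ.+ (p ℤ.+ q) ≡ (k ℤ.* x ℤ.+ p) ℤ.+ (k ℤ.* y ℤ.+ q)
  distrib = ℤ-Solver.solve-∀

U-· : ∀ c a g → U c (a ·ₚ g) ≈ₚ (a ·ₚ U c g)
U-· c a g K = trans (cong (ℤ._+_ ((+ K ℤ.- + c) ℤ.* (a ℤ.* g K))) (z·-· a g K))
                    (factor (+ K ℤ.- + c) a (g K) ((z· g) K))
  where
  factor : ∀ k a x p → k ℤ.* (a ℤ.* x) ℤ.+ a ℤ.* p ≡ a ℤ.* (k ℤ.* x ℤ.+ p)
  factor = ℤ-Solver.solve-∀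

U-comm : ∀ c d g → U c (U d g) ≈ₚ U d (U c g)
U-comm c d g zero = swap (+ 0) (+ c) (+ d) (g 0)
  where
  swap : ∀ k c d x → (k ℤ.- c) ℤ.* ((k ℤ.- d) ℤ.* x ℤ.+ + 0) ℤ.+ + 0 ≡ (k ℤ.- d) ℤ.* ((k ℤ.- c) ℤ.* x ℤ.+ + 0) ℤ.+ + 0
  swap = ℤ-Solver.solve-∀
U-comm c d g (suc K) = swap (+ suc K) (+ K) (+ c) (+ d) (g (suc K)) (g K) ((z· g) K)
  where
  swap : ∀ k₁ k₀ c d x₁ x₀ p →
    (k₁ ℤ.- c) ℤ.* ((k₁ ℤ.- d) ℤ.* x₁ ℤ.+ x₀) ℤ.+ ((k₀ ℤ.- d) ℤ.* x₀ ℤ.+ p)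
    ≡ (k₁ ℤ.- d) ℤ.* ((k₁ ℤ.- c) ℤ.* x₁ ℤ.+ x₀) ℤ.+ ((k₀ ℤ.- c) ℤ.* x₀ ℤ.+ p)
  swap = ℤ-Solver.solve-∀

U≈U₀- : ∀ c g → U c g ≈ₚ (U 0 g +ₚ ((- + c) ·ₚ g))
U≈U₀- c g K = split (+ K) (+ c) (g K) ((z· g) K)
  where
  split : ∀ k c x p → (k ℤ.- c) ℤ.* x ℤ.+ p ≡ ((k ℤ.- + 0) ℤ.* x ℤ.+ p) ℤ.+ (- c) ℤ.* x
  split = ℤ-Solver.solve-∀

U⋆-cong : ∀ cs {g h} → g ≈ₚ h → U⋆ cs g ≈ₚ U⋆ cs h
U⋆-cong [] g≈h = g≈h
U⋆-cong (c ∷ cs) g≈h = U-cong c (U⋆-cong cs g≈h)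

U⋆-+ : ∀ cs g h → U⋆ cs (g +ₚ h) ≈ₚ (U⋆ cs g +ₚ U⋆ cs h)
U⋆-+ [] g h K = refl
U⋆-+ (c ∷ cs) g h K = trans (U-cong c (U⋆-+ cs g h) K) (U-+ c (U⋆ cs g) (U⋆ cs h) K)

U⋆-· : ∀ cs a g → U⋆ cs (a ·ₚ g) ≈ₚ (a ·ₚ U⋆ cs g)
U⋆-· [] a g K = refl
U⋆-· (c ∷ cs) a g K = trans (U-cong c (U⋆-· cs a g) K) (U-· c a (U⋆ cs g) K)

U⋆-sum : ∀ cs n F → U⋆ cs (sumₚ n F) ≈ₚ sumₚ n (λ j → U⋆ cs (F j))
U⋆-sum cs zero F K = refl
U⋆-sum cs (suc n) F K =
  trans (U⋆-+ cs (sumₚ n F) (F (suc n)) K) (cong (ℤ._+ U⋆ cs (F (suc n)) K) (U⋆-sum cs n F K))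

U⋆-U-comm : ∀ cs d g → U⋆ cs (U d g) ≈ₚ U d (U⋆ cs g)
U⋆-U-comm [] d g K = refl
U⋆-U-comm (c ∷ cs) d g K = trans (U-cong c (U⋆-U-comm cs d g) K) (U-comm c d (U⋆ cs g) K)

U⋆-comm : ∀ cs ds g → U⋆ cs (U⋆ ds g) ≈ₚ U⋆ ds (U⋆ cs g)
U⋆-comm cs [] g K = refl
U⋆-comm cs (d ∷ ds) g K = trans (U⋆-U-comm cs d (U⋆ ds g) K) (U-cong d (U⋆-comm cs ds g) K)

U⋆-++ : ∀ cs ds g → U⋆ (cs ++ ds) g ≡ U⋆ cs (U⋆ ds g)
U⋆-++ cs ds g = Listₚ.foldr-++ U g cs ds

oneₚ : Poly
oneₚ zero = + 1
oneₚ (suc K) = + 0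

stirlingPoly : List ℕ → ℕ → Poly
stirlingPoly s N K = + stirling2s N K s

ℤ-recurrence : ∀ a c b K p → a + c * b ≡ K * b + p → + a ≡ (+ K ℤ.- + c) ℤ.* + b ℤ.+ + p
ℤ-recurrence a c b K p eq = begin
  + a                                    ≡⟨ cancel (+ a) (+ c ℤ.* + b) ⟩
  (+ a ℤ.+ + c ℤ.* + b) ℤ.- + c ℤ.* + b  ≡⟨ cong (ℤ._- + c ℤ.* + b) lifted ⟩
  (+ K ℤ.* + b ℤ.+ + p) ℤ.- + c ℤ.* + b  ≡⟨ regroup (+ K) (+ c) (+ b) (+ p) ⟩
  (+ K ℤ.- + c) ℤ.* + b ℤ.+ + p          ∎
  where
  open ≡-Reasoning
  cancel : ∀ x y → x ≡ (x ℤ.+ y) ℤ.- y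
  cancel = ℤ-Solver.solve-∀
  regroup : ∀ k c b p → (k ℤ.* b ℤ.+ p) ℤ.- c ℤ.* b ≡ (k ℤ.- c) ℤ.* b ℤ.+ p
  regroup = ℤ-Solver.solve-∀
  lifted : + a ℤ.+ + c ℤ.* + b ≡ + K ℤ.* + b ℤ.+ + p
  lifted = begin
    + a ℤ.+ + c ℤ.* + b ≡⟨ cong (ℤ._+_ (+ a)) (ℤₚ.pos-* c b) ⟨
    + a ℤ.+ + (c * b)   ≡⟨ ℤₚ.pos-+ a (c * b) ⟨
    + (a + c * b)       ≡⟨ cong +_ eq ⟩
    + (K * b + p)       ≡⟨ ℤₚ.pos-+ (K * b) p ⟩
    + (K * b) ℤ.+ + p   ≡⟨ cong (ℤ._+ + p) (ℤₚ.pos-* K b) ⟩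
    + K ℤ.* + b ℤ.+ + p ∎

stirlingPoly-suc : ∀ s N → stirlingPoly s (suc N) ≈ₚ U (rank s N) (stirlingPoly s N)
stirlingPoly-suc s N K =
  trans (ℤ-recurrence _ (rank s N) _ K _ (stirling2s-suc s N K)) (cong (ℤ._+_ scaled) (lowered K))
  where
  scaled : ℤ
  scaled = (+ K ℤ.- + rank s N) ℤ.* stirlingPoly s N K
  lowered : ∀ K → + below (λ K → stirling2s N K s) K ≡ (z· stirlingPoly s N) K
  lowered zero = refl
  lowered (suc K) = refl

sumₚ-cong : ∀ n {F G : ℕ → Poly} → (∀ j → j ≤ n → F j ≈ₚ G j) → sumₚ n F ≈ₚ sumₚ n G
sumₚ-cong zero F≈G K = F≈G 0 z≤n K
sumₚ-cong (suc n) F≈G K =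
  cong₂ ℤ._+_ (sumₚ-cong n (λ j j≤n → F≈G j (ℕₚ.m≤n⇒m≤1+n j≤n)) K) (F≈G (suc n) ℕₚ.≤-refl K)

sumₚ-· : ∀ n a F → sumₚ n (λ j → a ·ₚ F j) ≈ₚ (a ·ₚ sumₚ n F)
sumₚ-· zero a F K = refl
sumₚ-· (suc n) a F K =
  trans (cong (ℤ._+ a ℤ.* F (suc n) K) (sumₚ-· n a F K)) (sym (ℤₚ.*-distribˡ-+ a (sumₚ n F K) (F (suc n) K)))

U-combination : ∀ c (P : ℕ → Poly) (e : ℕ → ℤ) → (∀ j → U c (P j) ≈ₚ (P (suc j) +ₚ (e j ·ₚ P j))) →
  ∀ (α : Poly) D → α (suc D) ≡ + 0 →
  U c (sumₚ D (λ j → α j ·ₚ P j)) ≈ₚ sumₚ (suc D) (λ j → ((z· α) j ℤ.+ e j ℤ.* α j) ·ₚ P j)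
U-combination c P e UP α D α₊≡0 K = trans (partial D K) (cong (ℤ._+_ (sumₚ D β K)) lastTerm)
  where
  β : ℕ → Poly
  β j = ((z· α) j ℤ.+ e j ℤ.* α j) ·ₚ P j
  lastTerm : α D ℤ.* P (suc D) K ≡ ((z· α) (suc D) ℤ.+ e (suc D) ℤ.* α (suc D)) ℤ.* P (suc D) K
  lastTerm = sym (trans (cong (λ a → (α D ℤ.+ e (suc D) ℤ.* a) ℤ.* P (suc D) K) α₊≡0)
                        (drop (α D) (e (suc D)) (P (suc D) K)))
    where
    drop : ∀ a e x → (a ℤ.+ e ℤ.* + 0) ℤ.* x ≡ a ℤ.* x
    drop = ℤ-Solver.solve-∀
  partial : ∀ D K → U c (sumₚ D (λ j → α j ·ₚ P j)) K ≡ sumₚ D β K ℤ.+ α D ℤ.* P (suc D) K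
  partial zero K = trans (U-· c (α 0) (P 0) K) (trans (cong (α 0 ℤ.*_) (UP 0 K)) (first (α 0) (e 0) (P 0 K) (P 1 K)))
    where
    first : ∀ a e x₀ x₁ → a ℤ.* (x₁ ℤ.+ e ℤ.* x₀) ≡ (+ 0 ℤ.+ e ℤ.* a) ℤ.* x₀ ℤ.+ a ℤ.* x₁
    first = ℤ-Solver.solve-∀
  partial (suc D) K = begin
    U c (sumₚ D (λ j → α j ·ₚ P j) +ₚ (α (suc D) ·ₚ P (suc D))) K
      ≡⟨ U-+ c (sumₚ D (λ j → α j ·ₚ P j)) (α (suc D) ·ₚ P (suc D)) K ⟩
    U c (sumₚ D (λ j → α j ·ₚ P j)) K ℤ.+ U c (α (suc D) ·ₚ P (suc D)) K
      ≡⟨ cong₂ ℤ._+_ (partial D K) (trans (U-· c (α (suc D)) (P (suc D)) K) (cong (α (suc D) ℤ.*_) (UP (suc D) K))) ⟩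
    sumₚ D β K ℤ.+ α D ℤ.* P (suc D) K ℤ.+ α (suc D) ℤ.* (P (suc (suc D)) K ℤ.+ e (suc D) ℤ.* P (suc D) K)
      ≡⟨ next (sumₚ D β K) (α D) (α (suc D)) (e (suc D)) (P (suc D) K) (P (suc (suc D)) K) ⟩
    sumₚ (suc D) β K ℤ.+ α (suc D) ℤ.* P (suc (suc D)) K ∎
    where
    open ≡-Reasoning
    next : ∀ S a₀ a₁ e x₁ x₂ → S ℤ.+ a₀ ℤ.* x₁ ℤ.+ a₁ ℤ.* (x₂ ℤ.+ e ℤ.* x₁) ≡ S ℤ.+ (a₀ ℤ.+ e ℤ.* a₁) ℤ.* x₁ ℤ.+ a₁ ℤ.* x₂
    next = ℤ-Solver.solve-∀

DegreeAtMost : ℕ → Poly → Set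
DegreeAtMost d g = ∀ K → d < K → g K ≡ + 0

VanishesBelow : ℕ → Poly → Set
VanishesBelow a g = ∀ K → K < a → g K ≡ + 0

U-vanishing : ∀ c K g → g K ≡ + 0 → (z· g) K ≡ + 0 → U c g K ≡ + 0
U-vanishing c K g gK≡0 zgK≡0 = trans (cong₂ (λ u v → (+ K ℤ.- + c) ℤ.* u ℤ.+ v) gK≡0 zgK≡0)
                                     (cong (ℤ._+ + 0) (ℤₚ.*-zeroʳ (+ K ℤ.- + c)))

U-degree : ∀ c d g → DegreeAtMost d g → DegreeAtMost (suc d) (U c g)
U-degree c d g deg (suc K) (s≤s d<K) = U-vanishing c (suc K) g (deg (suc K) (ℕₚ.m<n⇒m<1+n d<K)) (deg K d<K)

U⋆-degree : ∀ cs d g → DegreeAtMost d g → DegreeAtMost (length cs + d) (U⋆ cs g)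
U⋆-degree [] d g deg = deg
U⋆-degree (c ∷ cs) d g deg = U-degree c (length cs + d) (U⋆ cs g) (U⋆-degree cs d g deg)

oneₚ-degree : DegreeAtMost 0 oneₚ
oneₚ-degree (suc K) _ = refl

z·-vanishesBelow : ∀ a g → VanishesBelow a g → VanishesBelow (suc a) (z· g)
z·-vanishesBelow a g van zero _ = refl
z·-vanishesBelow a g van (suc K) (s≤s K<a) = van K K<a

U-vanishesBelow : ∀ c a g → VanishesBelow a g → VanishesBelow a (U c g)
U-vanishesBelow c a g van K K<a = U-vanishing c K g (van K K<a) (z·-vanishesBelow a g van K (ℕₚ.m<n⇒m<1+n K<a))

U⋆-vanishesBelow : ∀ cs a g → VanishesBelow a g → VanishesBelow a (U⋆ cs g)
U⋆-vanishesBelow [] a g van = van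
U⋆-vanishesBelow (c ∷ cs) a g van = U-vanishesBelow c a (U⋆ cs g) (U⋆-vanishesBelow cs a g van)

-- the factor K − c of U c vanishes at K = c
U-raises-order : ∀ c g → VanishesBelow c g → VanishesBelow (suc c) (U c g)
U-raises-order c g van K (s≤s K≤c) with ℕₚ.m≤n⇒m<n∨m≡n K≤c
... | inj₁ K<c = U-vanishesBelow c c g van K K<c
... | inj₂ refl = trans (cancel (+ K) (g K) ((z· g) K)) (z·-vanishesBelow K g van K ℕₚ.≤-refl)
  where
  cancel : ∀ k x p → (k ℤ.- k) ℤ.* x ℤ.+ p ≡ p
  cancel = ℤ-Solver.solve-∀

falling : ℕ → ℕ → List ℕ
falling t j = applyDownFrom (_+_ t) j

falling-vanishesBelow : ∀ a g → VanishesBelow a (U⋆ (falling 0 a) g)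
falling-vanishesBelow zero g K ()
falling-vanishesBelow (suc a) g = U-raises-order a (U⋆ (falling 0 a) g) (falling-vanishesBelow a g)

falling-leading : ∀ t → U⋆ (falling 0 t) oneₚ t ≡ + 1
falling-leading zero = refl
falling-leading (suc t) =
  trans (cong₂ (λ u v → (+ suc t ℤ.- + t) ℤ.* u ℤ.+ v) (U⋆-degree (falling 0 t) 0 oneₚ oneₚ-degree (suc t) t<1+t)
                                                        (falling-leading t))
        (cong (ℤ._+ + 1) (ℤₚ.*-zeroʳ (+ suc t ℤ.- + t)))
  where
  t<1+t : length (falling 0 t) + 0 < suc t
  t<1+t = subst (_< suc t) (sym (trans (ℕₚ.+-identityʳ _) (Listₚ.length-applyDownFrom (_+_ 0) t))) (ℕₚ.n<1+n t)

ranks : List ℕ → ℕ → List ℕ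
ranks s N = applyDownFrom (rank s) N

stirlingPoly-ranks : ∀ s N → stirlingPoly s N ≈ₚ U⋆ (ranks s N) oneₚ
stirlingPoly-ranks s zero zero = refl
stirlingPoly-ranks s zero (suc K) = refl
stirlingPoly-ranks s (suc N) K =
  trans (stirlingPoly-suc s N K) (U-cong (rank s N) (stirlingPoly-ranks s N) K)

applyDownFrom-+ : ∀ (f : ℕ → A) m n → applyDownFrom f (m + n) ≡ applyDownFrom (λ i → f (i + n)) m ++ applyDownFrom f n
applyDownFrom-+ f zero n = refl
applyDownFrom-+ f (suc m) n = cong (f (m + n) ∷_) (applyDownFrom-+ f m n)

applyDownFrom-cong : ∀ {f g : ℕ → A} n → (∀ i → i < n → f i ≡ g i) → applyDownFrom f n ≡ applyDownFrom g n
applyDownFrom-cong zero f≡g = refl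
applyDownFrom-cong (suc n) f≡g = cong₂ _∷_ (f≡g n ℕₚ.≤-refl) (applyDownFrom-cong n (λ i i<n → f≡g i (ℕₚ.m<n⇒m<1+n i<n)))

applyDownFrom-const : ∀ (x : A) n → applyDownFrom (λ _ → x) n ≡ replicate n x
applyDownFrom-const x zero = refl
applyDownFrom-const x (suc n) = cong (x ∷_) (applyDownFrom-const x n)

rank-beyond : ∀ s N → sum s ≤ N → rank s N ≡ 0
rank-beyond [] N _ = refl
rank-beyond (a ∷ s) N a+s≤N =
  trans (if-false _ _ (≥⇒<ᵇ≡false (ℕₚ.≤-trans (ℕₚ.m≤m+n a (sum s)) a+s≤N)))
        (rank-beyond s (N ∸ a) (subst (_≤ N ∸ a) (ℕₚ.m+n∸m≡n a (sum s)) (ℕₚ.∸-monoˡ-≤ a a+s≤N)))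

rank-∷-low : ∀ b s i → i < b → rank (b ∷ s) i ≡ i
rank-∷-low b s i i<b = if-true _ _ (<⇒<ᵇ≡true i<b)

rank-∷-high : ∀ b s N → rank (b ∷ s) (N + b) ≡ rank s N
rank-∷-high b s N = trans (if-false _ _ (≥⇒<ᵇ≡false (ℕₚ.m≤n+m b N))) (cong (rank s) (ℕₚ.m+n∸n≡m N b))

rank-last : ∀ xs a i → i < a → rank (xs ++ a ∷ []) (i + sum xs) ≡ i
rank-last [] a i i<a = trans (cong (rank (a ∷ [])) (ℕₚ.+-identityʳ i)) (rank-∷-low a [] i i<a)
rank-last (b ∷ ys) a i i<a = begin
  rank (b ∷ ys ++ a ∷ []) (i + (b + sum ys)) ≡⟨ cong (rank (b ∷ ys ++ a ∷ [])) (+-left-comm i b (sum ys)) ⟩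
  rank (b ∷ ys ++ a ∷ []) (b + (i + sum ys)) ≡⟨ cong (rank (b ∷ ys ++ a ∷ [])) (ℕₚ.+-comm b (i + sum ys)) ⟩
  rank (b ∷ ys ++ a ∷ []) (i + sum ys + b)   ≡⟨ rank-∷-high b (ys ++ a ∷ []) (i + sum ys) ⟩
  rank (ys ++ a ∷ []) (i + sum ys)           ≡⟨ rank-last ys a i i<a ⟩
  i                                          ∎
  where open ≡-Reasoning

rank-init : ∀ xs a N → N < sum xs → rank (xs ++ a ∷ []) N ≡ rank xs N
rank-init [] a N ()
rank-init (b ∷ ys) a N N<b+ys with N ℕ.<? b
... | yes N<b = trans (rank-∷-low b (ys ++ a ∷ []) N N<b) (sym (rank-∷-low b ys N N<b))
... | no N≮b = begin
  rank (b ∷ ys ++ a ∷ []) N                    ≡⟨ cong (rank (b ∷ ys ++ a ∷ [])) N≡ ⟩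
  rank (b ∷ ys ++ a ∷ []) (N ∸ b + b)          ≡⟨ rank-∷-high b (ys ++ a ∷ []) (N ∸ b) ⟩
  rank (ys ++ a ∷ []) (N ∸ b)                  ≡⟨ rank-init ys a (N ∸ b) N∸b<ys ⟩
  rank ys (N ∸ b)                              ≡⟨ rank-∷-high b ys (N ∸ b) ⟨
  rank (b ∷ ys) (N ∸ b + b)                    ≡⟨ cong (rank (b ∷ ys)) N≡ ⟨
  rank (b ∷ ys) N                              ∎
  where
  open ≡-Reasoning
  N≡ : N ≡ N ∸ b + b
  N≡ = sym (ℕₚ.m∸n+n≡m (ℕₚ.≮⇒≥ N≮b))
  N∸b<ys : N ∸ b < sum ys
  N∸b<ys = ℕₚ.+-cancelˡ-< b (N ∸ b) (sum ys) (subst (_< b + sum ys) (sym (ℕₚ.m+[n∸m]≡n (ℕₚ.≮⇒≥ N≮b))) N<b+ys)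

ranks-∷ : ∀ b s N → ranks (b ∷ s) (N + b) ≡ ranks s N ++ falling 0 b
ranks-∷ b s N = begin
  ranks (b ∷ s) (N + b)                                             ≡⟨ applyDownFrom-+ (rank (b ∷ s)) N b ⟩
  applyDownFrom (λ i → rank (b ∷ s) (i + b)) N ++ ranks (b ∷ s) b  ≡⟨ cong₂ _++_ high low ⟩
  ranks s N ++ falling 0 b                                          ∎
  where
  open ≡-Reasoning
  high : applyDownFrom (λ i → rank (b ∷ s) (i + b)) N ≡ ranks s N
  high = applyDownFrom-cong N (λ i _ → rank-∷-high b s i)
  low : ranks (b ∷ s) b ≡ falling 0 b
  low = applyDownFrom-cong b (λ i i<b → rank-∷-low b s i i<b)

ranks-∷ʳ : ∀ xs a M → ranks (xs ++ a ∷ []) (M + (sum xs + a)) ≡ replicate M 0 ++ (falling 0 a ++ ranks xs (sum xs))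
ranks-∷ʳ xs a M = begin
  ranks s (M + (sum xs + a))
    ≡⟨ applyDownFrom-+ (rank s) M (sum xs + a) ⟩
  applyDownFrom (λ i → rank s (i + (sum xs + a))) M ++ ranks s (sum xs + a)
    ≡⟨ cong₂ _++_ (trans (applyDownFrom-cong M (λ i _ → rank-beyond s _ (beyond {i}))) (applyDownFrom-const 0 M))
                  (cong (ranks s) (ℕₚ.+-comm (sum xs) a)) ⟩
  replicate M 0 ++ ranks s (a + sum xs)
    ≡⟨ cong (replicate M 0 ++_) (applyDownFrom-+ (rank s) a (sum xs)) ⟩
  replicate M 0 ++ (applyDownFrom (λ i → rank s (i + sum xs)) a ++ ranks s (sum xs))
    ≡⟨ cong (λ l → replicate M 0 ++ l) (cong₂ _++_ (applyDownFrom-cong a (λ i i<a → rank-last xs a i i<a))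
                                                   (applyDownFrom-cong (sum xs) (λ i i<xs → rank-init xs a i i<xs))) ⟩
  replicate M 0 ++ (falling 0 a ++ ranks xs (sum xs)) ∎
  where
  open ≡-Reasoning
  s : List ℕ
  s = xs ++ a ∷ []
  beyond : ∀ {i} → sum s ≤ i + (sum xs + a)
  beyond {i} = subst (_≤ i + (sum xs + a)) (sym (trans (sum-++ xs (a ∷ [])) (cong (_+_ (sum xs)) (ℕₚ.+-identityʳ a))))
                     (ℕₚ.m≤n+m (sum xs + a) i)

base : List ℕ → Poly
base xs = U⋆ (ranks xs (sum xs)) oneₚ

-- B_M(z; xs ++ (a)) with the coefficient of z^k stored at index k + a
bellPoly : List ℕ → ℕ → ℕ → Poly
bellPoly xs M a = U⋆ (replicate M 0) (U⋆ (falling 0 a) (base xs))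

stirlingPoly-bellPoly : ∀ xs a M → stirlingPoly (xs ++ a ∷ []) (M + (sum xs + a)) ≈ₚ bellPoly xs M a
stirlingPoly-bellPoly xs a M K = begin
  stirlingPoly (xs ++ a ∷ []) (M + (sum xs + a)) K
    ≡⟨ stirlingPoly-ranks (xs ++ a ∷ []) (M + (sum xs + a)) K ⟩
  U⋆ (ranks (xs ++ a ∷ []) (M + (sum xs + a))) oneₚ K
    ≡⟨ cong (λ cs → U⋆ cs oneₚ K) (ranks-∷ʳ xs a M) ⟩
  U⋆ (replicate M 0 ++ (falling 0 a ++ ranks xs (sum xs))) oneₚ K
    ≡⟨ cong (λ g → g K) (trans (U⋆-++ (replicate M 0) _ oneₚ) (cong (U⋆ (replicate M 0)) (U⋆-++ (falling 0 a) _ oneₚ))) ⟩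
  bellPoly xs M a K ∎
  where open ≡-Reasoning

bellPoly-degree : ∀ xs M a → DegreeAtMost (M + (sum xs + a)) (bellPoly xs M a)
bellPoly-degree xs M a K bound =
  U⋆-degree (replicate M 0) _ _ (U⋆-degree (falling 0 a) _ _ (U⋆-degree (ranks xs (sum xs)) 0 oneₚ oneₚ-degree)) K
            (subst (_< K) lengths bound)
  where
  lengths : M + (sum xs + a) ≡ length (replicate M 0) + (length (falling 0 a) + (length (ranks xs (sum xs)) + 0))
  lengths = cong₂ _+_ (sym (Listₚ.length-replicate M))
    (trans (ℕₚ.+-comm (sum xs) a)
           (cong₂ _+_ (sym (Listₚ.length-applyDownFrom (_+_ 0) a))
                      (sym (trans (ℕₚ.+-identityʳ _) (Listₚ.length-applyDownFrom (rank xs) (sum xs))))))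

bellPoly-vanishesBelow : ∀ xs M a → VanishesBelow a (bellPoly xs M a)
bellPoly-vanishesBelow xs M a = U⋆-vanishesBelow (replicate M 0) a _ (falling-vanishesBelow a (base xs))

-- Changes of basis between powers of U 0 and falling products

U₀-power-expansion : ∀ t (σ : ℕ → Poly) → σ 0 0 ≡ + 1 →
  (∀ n j → σ (suc n) j ≡ (z· σ n) j ℤ.+ + (t + j) ℤ.* σ n j) → (∀ n → σ n (suc n) ≡ + 0) →
  ∀ n h → U⋆ (replicate n 0) h ≈ₚ sumₚ n (λ j → σ n j ·ₚ U⋆ (falling t j) h)
U₀-power-expansion t σ σ₀₀ σ-suc σ-top zero h K = sym (trans (cong (ℤ._* h K) σ₀₀) (ℤₚ.*-identityˡ (h K)))
U₀-power-expansion t σ σ₀₀ σ-suc σ-top (suc n) h K =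
  trans (U-cong 0 (U₀-power-expansion t σ σ₀₀ σ-suc σ-top n h) K)
  (trans (U-combination 0 (λ j → U⋆ (falling t j) h) (λ j → + (t + j)) U₀-falling (σ n) n (σ-top n) K)
         (sumₚ-cong (suc n) (λ j _ K → cong (ℤ._* U⋆ (falling t j) h K) (sym (σ-suc n j))) K))
  where
  U₀-falling : ∀ j → U 0 (U⋆ (falling t j) h) ≈ₚ (U⋆ (falling t (suc j)) h +ₚ ((+ (t + j)) ·ₚ U⋆ (falling t j) h))
  U₀-falling j K = trans (rebalance (U 0 g K) (+ (t + j)) (g K)) (cong (ℤ._+ + (t + j) ℤ.* g K) (sym (U≈U₀- (t + j) g K)))
    where
    g : Poly
    g = U⋆ (falling t j) h
    rebalance : ∀ u c x → u ≡ (u ℤ.+ (- c) ℤ.* x) ℤ.+ c ℤ.* x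
    rebalance = ℤ-Solver.solve-∀

falling-expansion : ∀ t (τ : ℕ → Poly) → τ 0 0 ≡ + 1 →
  (∀ n j → τ (suc n) j ≡ (z· τ n) j ℤ.+ (- + (t + n)) ℤ.* τ n j) → (∀ n → τ n (suc n) ≡ + 0) →
  ∀ n h → U⋆ (falling t n) h ≈ₚ sumₚ n (λ j → τ n j ·ₚ U⋆ (replicate j 0) h)
falling-expansion t τ τ₀₀ τ-suc τ-top zero h K = sym (trans (cong (ℤ._* h K) τ₀₀) (ℤₚ.*-identityˡ (h K)))
falling-expansion t τ τ₀₀ τ-suc τ-top (suc n) h K =
  trans (U-cong (t + n) (falling-expansion t τ τ₀₀ τ-suc τ-top n h) K)
  (trans (U-combination (t + n) (λ j → U⋆ (replicate j 0) h) (λ _ → - + (t + n))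
                        (λ j → U≈U₀- (t + n) (U⋆ (replicate j 0) h)) (τ n) n (τ-top n) K)
         (sumₚ-cong (suc n) (λ j _ K → cong (ℤ._* U⋆ (replicate j 0) h K) (sym (τ-suc n j))) K))

sumℕ-suc : ∀ n f → sumℕ (suc n) f ≡ f 0 + sumℕ n (f ∘ suc)
sumℕ-suc zero f = refl
sumℕ-suc (suc n) f = trans (cong (_+ f (suc (suc n))) (sumℕ-suc n f)) (ℕₚ.+-assoc (f 0) _ _)

sumℕ-cong : ∀ n {f g : ℕ → ℕ} → (∀ j → f j ≡ g j) → sumℕ n f ≡ sumℕ n g
sumℕ-cong zero f≡g = f≡g 0
sumℕ-cong (suc n) f≡g = cong₂ _+_ (sumℕ-cong n f≡g) (f≡g (suc n))

sumℕ-+ : ∀ n f g → sumℕ n (λ j → f j + g j) ≡ sumℕ n f + sumℕ n g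
sumℕ-+ zero f g = refl
sumℕ-+ (suc n) f g = trans (cong (_+ (f (suc n) + g (suc n))) (sumℕ-+ n f g))
                           (+-interchange (sumℕ n f) (sumℕ n g) (f (suc n)) (g (suc n)))

sumℕ-* : ∀ n c f → sumℕ n (λ j → c * f j) ≡ c * sumℕ n f
sumℕ-* zero c f = refl
sumℕ-* (suc n) c f = trans (cong (_+ c * f (suc n)) (sumℕ-* n c f)) (sym (ℕₚ.*-distribˡ-+ c (sumℕ n f) (f (suc n))))

sumℕ-zero : ∀ n → sumℕ n (λ _ → 0) ≡ 0
sumℕ-zero zero = refl
sumℕ-zero (suc n) = cong (_+ 0) (sumℕ-zero n)

compSum-0∷ : ∀ ys l → compSum (0 ∷ ys) l ≡ compSum ys l
compSum-0∷ ys zero = ℕₚ.+-identityʳ _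
compSum-0∷ ys (suc l) = trans (sumℕ-suc l _) (trans (cong₂ _+_ (ℕₚ.+-identityʳ _) (sumℕ-zero l)) (ℕₚ.+-identityʳ _))

-- [b 0] vanishes unless b = 0
*-stirling1-zero : ∀ b x → b * (stirling1 b 0 * x) ≡ 0
*-stirling1-zero zero x = refl
*-stirling1-zero (suc b) x = ℕₚ.*-zeroʳ (suc b)

compSum-suc∷ : ∀ b ys l → compSum (suc b ∷ ys) l ≡ b * compSum (b ∷ ys) l + below (compSum (b ∷ ys)) l
compSum-suc∷ b ys zero = sym (trans (ℕₚ.+-identityʳ _) (*-stirling1-zero b (compSum ys 0)))
compSum-suc∷ b ys (suc l) = begin
  compSum (suc b ∷ ys) (suc l)
    ≡⟨ sumℕ-suc l _ ⟩
  0 + sumℕ l (λ j → stirling1 (suc b) (suc j) * C (l ∸ j))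
    ≡⟨ sumℕ-cong l (λ j → distrib b (stirling1 b (suc j)) (stirling1 b j) (C (l ∸ j))) ⟩
  sumℕ l (λ j → b * (stirling1 b (suc j) * C (l ∸ j)) + stirling1 b j * C (l ∸ j))
    ≡⟨ sumℕ-+ l _ _ ⟩
  sumℕ l (λ j → b * (stirling1 b (suc j) * C (l ∸ j))) + compSum (b ∷ ys) l
    ≡⟨ cong (_+ compSum (b ∷ ys) l) (sumℕ-* l b _) ⟩
  b * sumℕ l (λ j → stirling1 b (suc j) * C (l ∸ j)) + compSum (b ∷ ys) l
    ≡⟨ cong (_+ compSum (b ∷ ys) l) leading ⟨
  b * compSum (b ∷ ys) (suc l) + compSum (b ∷ ys) l ∎
  where
  open ≡-Reasoning
  C : ℕ → ℕ
  C = compSum ys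
  distrib : ∀ b s₁ s₀ c → (b * s₁ + s₀) * c ≡ b * (s₁ * c) + s₀ * c
  distrib = solve-∀
  leading : b * compSum (b ∷ ys) (suc l) ≡ b * sumℕ l (λ j → stirling1 b (suc j) * C (l ∸ j))
  leading = begin
    b * compSum (b ∷ ys) (suc l)
      ≡⟨ cong (b *_) (sumℕ-suc l _) ⟩
    b * (stirling1 b 0 * C (suc l) + sumℕ l (λ j → stirling1 b (suc j) * C (l ∸ j)))
      ≡⟨ ℕₚ.*-distribˡ-+ b _ _ ⟩
    b * (stirling1 b 0 * C (suc l)) + b * sumℕ l (λ j → stirling1 b (suc j) * C (l ∸ j))
      ≡⟨ cong (_+ b * sumℕ l (λ j → stirling1 b (suc j) * C (l ∸ j))) (*-stirling1-zero b (C (suc l))) ⟩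
    b * sumℕ l (λ j → stirling1 b (suc j) * C (l ∸ j)) ∎

compSum-beyond : ∀ xs l → sum xs < l → compSum xs l ≡ 0
compSum-beyond [] (suc l) _ = refl
compSum-beyond (b ∷ ys) l b+ys<l = go b l b+ys<l
  where
  go : ∀ b l → b + sum ys < l → compSum (b ∷ ys) l ≡ 0
  go zero l ys<l = trans (compSum-0∷ ys l) (compSum-beyond ys l ys<l)
  go (suc b) (suc l) (s≤s b+ys<l) =
    trans (compSum-suc∷ b ys (suc l))
          (cong₂ _+_ (trans (cong (b *_) (go b (suc l) (ℕₚ.m<n⇒m<1+n b+ys<l))) (ℕₚ.*-zeroʳ b)) (go b l b+ys<l))

pos-*-+ : ∀ b c d → + (b * c + d) ≡ + b ℤ.* + c ℤ.+ + d
pos-*-+ b c d = trans (ℤₚ.pos-+ (b * c) d) (cong (ℤ._+ + d) (ℤₚ.pos-* b c))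

signPow-∸-suc : ∀ m l c → (m ≤ l → c ≡ 0) → signPow (m ∸ l) ℤ.* + c ≡ - (signPow (m ∸ suc l) ℤ.* + c)
signPow-∸-suc m l c vanish with l ℕ.<? m
... | yes l<m = trans (cong (λ e → signPow e ℤ.* + c) (ℕₚ.+-∸-assoc 1 l<m)) (sym (ℤₚ.neg-distribˡ-* (signPow (m ∸ suc l)) (+ c)))
... | no l≮m rewrite vanish (ℕₚ.≮⇒≥ l≮m) =
  trans (ℤₚ.*-zeroʳ (signPow (m ∸ l))) (sym (cong -_ (ℤₚ.*-zeroʳ (signPow (m ∸ suc l)))))

aCoeff-0∷ : ∀ ys l → aCoeff l (0 ∷ ys) ≡ aCoeff l ys
aCoeff-0∷ ys l = cong (λ c → signPow (sum ys ∸ l) ℤ.* + c) (compSum-0∷ ys l)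

-- (x)_{b+1} = (x)_b (x − b) on the coefficients of Π_j (x)_{r_j} = Σ_i a_i x^i
aCoeff-suc∷ : ∀ b ys l →
  aCoeff l (suc b ∷ ys) ≡ (z· (λ i → aCoeff i (b ∷ ys))) l ℤ.+ (- + b) ℤ.* aCoeff l (b ∷ ys)
aCoeff-suc∷ b ys zero =
  trans (cong (λ c → signPow (suc m) ℤ.* c) (trans (cong +_ (compSum-suc∷ b ys 0)) (pos-*-+ b (C 0) 0)))
        (shift (signPow m) (+ b) (+ C 0))
  where
  m : ℕ
  m = b + sum ys
  C : ℕ → ℕ
  C = compSum (b ∷ ys)
  shift : ∀ s b c → (- s) ℤ.* (b ℤ.* c ℤ.+ + 0) ≡ + 0 ℤ.+ (- b) ℤ.* (s ℤ.* c)
  shift = ℤ-Solver.solve-∀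
aCoeff-suc∷ b ys (suc l) = begin
  s₀ ℤ.* + compSum (suc b ∷ ys) (suc l)
    ≡⟨ cong (s₀ ℤ.*_) (trans (cong +_ (compSum-suc∷ b ys (suc l))) (pos-*-+ b (C (suc l)) (C l))) ⟩
  s₀ ℤ.* (+ b ℤ.* + C (suc l) ℤ.+ + C l)
    ≡⟨ expand s₀ (+ b) (+ C (suc l)) (+ C l) ⟩
  + b ℤ.* (s₀ ℤ.* + C (suc l)) ℤ.+ s₀ ℤ.* + C l
    ≡⟨ cong (λ x → + b ℤ.* x ℤ.+ s₀ ℤ.* + C l) (signPow-∸-suc m l (C (suc l)) (λ m≤l → compSum-beyond (b ∷ ys) (suc l) (s≤s m≤l))) ⟩
  + b ℤ.* (- (s₁ ℤ.* + C (suc l))) ℤ.+ s₀ ℤ.* + C l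
    ≡⟨ collect (+ b) (s₁ ℤ.* + C (suc l)) (s₀ ℤ.* + C l) ⟩
  s₀ ℤ.* + C l ℤ.+ (- + b) ℤ.* (s₁ ℤ.* + C (suc l)) ∎
  where
  open ≡-Reasoning
  m : ℕ
  m = b + sum ys
  s₀ s₁ : ℤ
  s₀ = signPow (m ∸ l)
  s₁ = signPow (m ∸ suc l)
  C : ℕ → ℕ
  C = compSum (b ∷ ys)
  expand : ∀ s b c₁ c₀ → s ℤ.* (b ℤ.* c₁ ℤ.+ c₀) ≡ b ℤ.* (s ℤ.* c₁) ℤ.+ s ℤ.* c₀
  expand = ℤ-Solver.solve-∀
  collect : ∀ b x y → b ℤ.* (- x) ℤ.+ y ≡ y ℤ.+ (- b) ℤ.* x
  collect = ℤ-Solver.solve-∀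

U₀-powers : ℕ → Poly
U₀-powers i = U⋆ (replicate i 0) oneₚ

falling-U₀-combination : ∀ ys b →
  U⋆ (falling 0 b) (sumₚ (sum ys) (λ i → aCoeff i ys ·ₚ U₀-powers i))
  ≈ₚ sumₚ (b + sum ys) (λ l → aCoeff l (b ∷ ys) ·ₚ U₀-powers l)
falling-U₀-combination ys zero = sumₚ-cong (sum ys) (λ l _ K → cong (ℤ._* U₀-powers l K) (sym (aCoeff-0∷ ys l)))
falling-U₀-combination ys (suc b) K =
  trans (U-cong b (falling-U₀-combination ys b) K)
  (trans (U-combination b U₀-powers (λ _ → - + b) (λ j → U≈U₀- b (U₀-powers j)) (λ l → aCoeff l (b ∷ ys)) (b + sum ys) top K)
         (sumₚ-cong (suc (b + sum ys)) (λ l _ K → cong (ℤ._* U₀-powers l K) (sym (aCoeff-suc∷ b ys l))) K))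
  where
  top : aCoeff (suc (b + sum ys)) (b ∷ ys) ≡ + 0
  top = trans (cong (λ c → signPow (b + sum ys ∸ suc (b + sum ys)) ℤ.* + c)
                    (compSum-beyond (b ∷ ys) (suc (b + sum ys)) ℕₚ.≤-refl))
              (ℤₚ.*-zeroʳ (signPow (b + sum ys ∸ suc (b + sum ys))))

base-expansion : ∀ xs → base xs ≈ₚ sumₚ (sum xs) (λ i → aCoeff i xs ·ₚ U₀-powers i)
base-expansion [] K = sym (ℤₚ.*-identityˡ (oneₚ K))
base-expansion (b ∷ ys) K = begin
  U⋆ (ranks (b ∷ ys) (b + sum ys)) oneₚ K
    ≡⟨ cong (λ cs → U⋆ cs oneₚ K) (trans (cong (ranks (b ∷ ys)) (ℕₚ.+-comm b (sum ys))) (ranks-∷ b ys (sum ys))) ⟩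
  U⋆ (ranks ys (sum ys) ++ falling 0 b) oneₚ K
    ≡⟨ cong (λ g → g K) (U⋆-++ (ranks ys (sum ys)) (falling 0 b) oneₚ) ⟩
  U⋆ (ranks ys (sum ys)) (U⋆ (falling 0 b) oneₚ) K
    ≡⟨ U⋆-comm (ranks ys (sum ys)) (falling 0 b) oneₚ K ⟩
  U⋆ (falling 0 b) (base ys) K
    ≡⟨ U⋆-cong (falling 0 b) (base-expansion ys) K ⟩
  U⋆ (falling 0 b) (sumₚ (sum ys) (λ i → aCoeff i ys ·ₚ U₀-powers i)) K
    ≡⟨ falling-U₀-combination ys b K ⟩
  sumₚ (b + sum ys) (λ l → aCoeff l (b ∷ ys) ·ₚ U₀-powers l) K ∎
  where open ≡-Reasoning

rStirling2ℤ : ℕ → ℕ → Poly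
rStirling2ℤ t n j = + rStirling2 (n + t) (j + t) t

rStirling2ℤ≡bellPoly : ∀ t n j → rStirling2ℤ t n j ≡ bellPoly [] n t (j + t)
rStirling2ℤ≡bellPoly t n j = stirlingPoly-bellPoly [] t n (j + t)

rStirling2ℤ-suc : ∀ t n j → rStirling2ℤ t (suc n) j ≡ (z· rStirling2ℤ t n) j ℤ.+ + (t + j) ℤ.* rStirling2ℤ t n j
rStirling2ℤ-suc t n j = begin
  rStirling2ℤ t (suc n) j
    ≡⟨ rStirling2ℤ≡bellPoly t (suc n) j ⟩
  (+ (j + t) ℤ.- + 0) ℤ.* g (j + t) ℤ.+ (z· g) (j + t)
    ≡⟨ cong₂ (λ x y → (+ (j + t) ℤ.- + 0) ℤ.* x ℤ.+ y) (sym (rStirling2ℤ≡bellPoly t n j)) (lowered j) ⟩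
  (+ (j + t) ℤ.- + 0) ℤ.* rStirling2ℤ t n j ℤ.+ (z· rStirling2ℤ t n) j
    ≡⟨ cong (λ k → (+ k ℤ.- + 0) ℤ.* rStirling2ℤ t n j ℤ.+ (z· rStirling2ℤ t n) j) (ℕₚ.+-comm j t) ⟩
  (+ (t + j) ℤ.- + 0) ℤ.* rStirling2ℤ t n j ℤ.+ (z· rStirling2ℤ t n) j
    ≡⟨ swap (+ (t + j)) (rStirling2ℤ t n j) ((z· rStirling2ℤ t n) j) ⟩
  (z· rStirling2ℤ t n) j ℤ.+ + (t + j) ℤ.* rStirling2ℤ t n j ∎
  where
  open ≡-Reasoning
  g : Poly
  g = bellPoly [] n t
  swap : ∀ k x p → (k ℤ.- + 0) ℤ.* x ℤ.+ p ≡ p ℤ.+ k ℤ.* x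
  swap = ℤ-Solver.solve-∀
  lowered : ∀ j → (z· g) (j + t) ≡ (z· rStirling2ℤ t n) j
  lowered (suc j) = sym (rStirling2ℤ≡bellPoly t n j)
  lowered zero = start t
    where
    start : ∀ t → (z· bellPoly [] n t) t ≡ + 0
    start zero = refl
    start (suc t) = bellPoly-vanishesBelow [] n (suc t) t ℕₚ.≤-refl

rStirling2ℤ-00 : ∀ t → rStirling2ℤ t 0 0 ≡ + 1
rStirling2ℤ-00 t = trans (rStirling2ℤ≡bellPoly t 0 0) (falling-leading t)

rStirling2ℤ-top : ∀ t n → rStirling2ℤ t n (suc n) ≡ + 0
rStirling2ℤ-top t n = trans (rStirling2ℤ≡bellPoly t n (suc n)) (bellPoly-degree [] n t (suc n + t) ℕₚ.≤-refl)

signedRStirling1 : ℕ → ℕ → Poly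
signedRStirling1 t n j = + rStirling1 (n + t) (j + t) t ℤ.* signPow (n ∸ j)

signedRStirling1-00 : ∀ t → signedRStirling1 t 0 0 ≡ + 1
signedRStirling1-00 t = cong (λ c → + c ℤ.* + 1) (rStirling1-diagonal t t ℕₚ.≤-refl)

signedRStirling1-top : ∀ t n → signedRStirling1 t n (suc n) ≡ + 0
signedRStirling1-top t n = cong (λ c → + c ℤ.* signPow (n ∸ suc n)) (rStirling1-above t (n + t) (suc n + t) ℕₚ.≤-refl)

signedRStirling1-suc : ∀ t n j →
  signedRStirling1 t (suc n) j ≡ (z· signedRStirling1 t n) j ℤ.+ (- + (t + n)) ℤ.* signedRStirling1 t n j
signedRStirling1-suc t n j = begin
  + rStirling1 (suc (n + t)) (j + t) t ℤ.* signPow (suc n ∸ j)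
    ≡⟨ cong (λ c → + c ℤ.* signPow (suc n ∸ j)) (rStirling1-suc-outside t (n + t) (j + t) (ℕₚ.m≤n+m t n)) ⟩
  + ((n + t) * a + p) ℤ.* signPow (suc n ∸ j)
    ≡⟨ cong (ℤ._* signPow (suc n ∸ j)) (pos-*-+ (n + t) a p) ⟩
  (+ (n + t) ℤ.* + a ℤ.+ + p) ℤ.* signPow (suc n ∸ j)
    ≡⟨ expand (+ (n + t)) (+ a) (+ p) (signPow (suc n ∸ j)) ⟩
  + (n + t) ℤ.* (+ a ℤ.* signPow (suc n ∸ j)) ℤ.+ + p ℤ.* signPow (suc n ∸ j)
    ≡⟨ cong₂ (λ x y → + (n + t) ℤ.* x ℤ.+ y) alternate (lowered j) ⟩
  + (n + t) ℤ.* (- signedRStirling1 t n j) ℤ.+ (z· signedRStirling1 t n) j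
    ≡⟨ cong (λ k → + k ℤ.* (- signedRStirling1 t n j) ℤ.+ (z· signedRStirling1 t n) j) (ℕₚ.+-comm n t) ⟩
  + (t + n) ℤ.* (- signedRStirling1 t n j) ℤ.+ (z· signedRStirling1 t n) j
    ≡⟨ collect (+ (t + n)) (signedRStirling1 t n j) ((z· signedRStirling1 t n) j) ⟩
  (z· signedRStirling1 t n) j ℤ.+ (- + (t + n)) ℤ.* signedRStirling1 t n j ∎
  where
  open ≡-Reasoning
  a p : ℕ
  a = rStirling1 (n + t) (j + t) t
  p = below (λ K → rStirling1 (n + t) K t) (j + t)
  expand : ∀ k a p s → (k ℤ.* a ℤ.+ p) ℤ.* s ≡ k ℤ.* (a ℤ.* s) ℤ.+ p ℤ.* s
  expand = ℤ-Solver.solve-∀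
  collect : ∀ k x y → k ℤ.* (- x) ℤ.+ y ≡ y ℤ.+ (- k) ℤ.* x
  collect = ℤ-Solver.solve-∀
  alternate : + a ℤ.* signPow (suc n ∸ j) ≡ - signedRStirling1 t n j
  alternate = begin
    + a ℤ.* signPow (suc n ∸ j)        ≡⟨ ℤₚ.*-comm (+ a) _ ⟩
    signPow (suc n ∸ j) ℤ.* + a        ≡⟨ signPow-∸-suc (suc n) j a (λ n<j → rStirling1-above t (n + t) (j + t) (ℕₚ.+-monoˡ-≤ t n<j)) ⟩
    - (signPow (n ∸ j) ℤ.* + a)        ≡⟨ cong -_ (ℤₚ.*-comm _ (+ a)) ⟩
    - signedRStirling1 t n j           ∎
  lowered : ∀ j → + below (λ K → rStirling1 (n + t) K t) (j + t) ℤ.* signPow (suc n ∸ j) ≡ (z· signedRStirling1 t n) j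
  lowered (suc j) = refl
  lowered zero = trans (cong (λ c → + c ℤ.* signPow (suc n)) (vanishes t)) (ℤₚ.*-zeroˡ (signPow (suc n)))
    where
    vanishes : ∀ t → below (λ K → rStirling1 (n + t) K t) t ≡ 0
    vanishes zero = refl
    vanishes (suc t) = rStirling1-below (suc t) (n + suc t) t ℕₚ.≤-refl (ℕₚ.m≤n+m (suc t) n)

U₀-power-+ : ∀ m n g → U⋆ (replicate (m + n) 0) g ≡ U⋆ (replicate m 0) (U⋆ (replicate n 0) g)
U₀-power-+ zero n g = refl
U₀-power-+ (suc m) n g = cong (U 0) (U₀-power-+ m n g)

falling-+ : ∀ t j g → U⋆ (falling 0 (t + j)) g ≡ U⋆ (falling t j) (U⋆ (falling 0 t) g)
falling-+ t zero g = cong (λ k → U⋆ (falling 0 k) g) (ℕₚ.+-identityʳ t)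
falling-+ t (suc j) g = trans (cong (λ k → U⋆ (falling 0 k) g) (ℕₚ.+-suc t j)) (cong (U (t + j)) (falling-+ t j g))

bellPoly-expansion-rStirling2 : ∀ xs t n m →
  bellPoly xs (n + m) t ≈ₚ sumₚ n (λ j → rStirling2ℤ t n j ·ₚ bellPoly xs m (t + j))
bellPoly-expansion-rStirling2 xs t n m K = begin
  U⋆ (replicate (n + m) 0) G K
    ≡⟨ cong (λ g → g K) (trans (cong (λ k → U⋆ (replicate k 0) G) (ℕₚ.+-comm n m)) (U₀-power-+ m n G)) ⟩
  U⋆ (replicate m 0) (U⋆ (replicate n 0) G) K
    ≡⟨ U⋆-cong (replicate m 0) (U₀-power-expansion t (rStirling2ℤ t) (rStirling2ℤ-00 t)
                                                   (rStirling2ℤ-suc t) (rStirling2ℤ-top t) n G) K ⟩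
  U⋆ (replicate m 0) (sumₚ n (λ j → rStirling2ℤ t n j ·ₚ U⋆ (falling t j) G)) K
    ≡⟨ U⋆-sum (replicate m 0) n _ K ⟩
  sumₚ n (λ j → U⋆ (replicate m 0) (rStirling2ℤ t n j ·ₚ U⋆ (falling t j) G)) K
    ≡⟨ sumₚ-cong n (λ j _ K → trans (U⋆-· (replicate m 0) (rStirling2ℤ t n j) _ K)
                                    (cong (λ g → rStirling2ℤ t n j ℤ.* U⋆ (replicate m 0) g K) (sym (falling-+ t j (base xs))))) K ⟩
  sumₚ n (λ j → rStirling2ℤ t n j ·ₚ bellPoly xs m (t + j)) K ∎
  where
  open ≡-Reasoning
  G : Poly
  G = U⋆ (falling 0 t) (base xs)

bellPoly-expansion-rStirling1 : ∀ xs t n m →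
  bellPoly xs m (t + n) ≈ₚ sumₚ n (λ j → signedRStirling1 t n j ·ₚ bellPoly xs (m + j) t)
bellPoly-expansion-rStirling1 xs t n m K = begin
  U⋆ (replicate m 0) (U⋆ (falling 0 (t + n)) (base xs)) K
    ≡⟨ cong (λ g → U⋆ (replicate m 0) g K) (falling-+ t n (base xs)) ⟩
  U⋆ (replicate m 0) (U⋆ (falling t n) G) K
    ≡⟨ U⋆-cong (replicate m 0) (falling-expansion t (signedRStirling1 t) (signedRStirling1-00 t)
                                                  (signedRStirling1-suc t) (signedRStirling1-top t) n G) K ⟩
  U⋆ (replicate m 0) (sumₚ n (λ j → signedRStirling1 t n j ·ₚ U⋆ (replicate j 0) G)) K
    ≡⟨ U⋆-sum (replicate m 0) n _ K ⟩
  sumₚ n (λ j → U⋆ (replicate m 0) (signedRStirling1 t n j ·ₚ U⋆ (replicate j 0) G)) K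
    ≡⟨ sumₚ-cong n (λ j _ K → trans (U⋆-· (replicate m 0) (signedRStirling1 t n j) _ K)
                                    (cong (λ g → signedRStirling1 t n j ℤ.* g K) (sym (U₀-power-+ m j G)))) K ⟩
  sumₚ n (λ j → signedRStirling1 t n j ·ₚ bellPoly xs (m + j) t) K ∎
  where
  open ≡-Reasoning
  G : Poly
  G = U⋆ (falling 0 t) (base xs)

bellPoly-expansion-rBell : ∀ xs t n m →
  bellPoly xs (n + m) t
  ≈ₚ sumₚ (sum xs) (λ i → sumₚ n (λ j → (rStirling2ℤ t n j ℤ.* aCoeff i xs) ·ₚ bellPoly [] (m + i) (t + j)))
bellPoly-expansion-rBell xs t n m K = begin
  U⋆ (replicate (n + m) 0) (U⋆ (falling 0 t) (base xs)) K
    ≡⟨ U⋆-cong (replicate (n + m) 0) (U⋆-cong (falling 0 t) (base-expansion xs)) K ⟩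
  U⋆ (replicate (n + m) 0) (U⋆ (falling 0 t) (sumₚ (sum xs) (λ i → aCoeff i xs ·ₚ U₀-powers i))) K
    ≡⟨ trans (U⋆-cong (replicate (n + m) 0) (U⋆-sum (falling 0 t) (sum xs) _) K)
             (U⋆-sum (replicate (n + m) 0) (sum xs) _ K) ⟩
  sumₚ (sum xs) (λ i → U⋆ (replicate (n + m) 0) (U⋆ (falling 0 t) (aCoeff i xs ·ₚ U₀-powers i))) K
    ≡⟨ sumₚ-cong (sum xs) (λ i _ → perTerm i) K ⟩
  sumₚ (sum xs) (λ i → sumₚ n (λ j → (rStirling2ℤ t n j ℤ.* aCoeff i xs) ·ₚ bellPoly [] (m + i) (t + j))) K ∎
  where
  open ≡-Reasoning
  perTerm : ∀ i → U⋆ (replicate (n + m) 0) (U⋆ (falling 0 t) (aCoeff i xs ·ₚ U₀-powers i))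
                  ≈ₚ sumₚ n (λ j → (rStirling2ℤ t n j ℤ.* aCoeff i xs) ·ₚ bellPoly [] (m + i) (t + j))
  perTerm i K = begin
    U⋆ (replicate (n + m) 0) (U⋆ (falling 0 t) (aCoeff i xs ·ₚ U₀-powers i)) K
      ≡⟨ trans (U⋆-cong (replicate (n + m) 0) (U⋆-· (falling 0 t) (aCoeff i xs) (U₀-powers i)) K)
               (U⋆-· (replicate (n + m) 0) (aCoeff i xs) _ K) ⟩
    aCoeff i xs ℤ.* U⋆ (replicate (n + m) 0) (U⋆ (falling 0 t) (U₀-powers i)) K
      ≡⟨ cong (aCoeff i xs ℤ.*_) (U⋆-cong (replicate (n + m) 0) (U⋆-comm (falling 0 t) (replicate i 0) oneₚ) K) ⟩
    aCoeff i xs ℤ.* U⋆ (replicate (n + m) 0) (U⋆ (replicate i 0) (U⋆ (falling 0 t) oneₚ)) K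
      ≡⟨ cong (λ g → aCoeff i xs ℤ.* g K)
              (trans (sym (U₀-power-+ (n + m) i (U⋆ (falling 0 t) oneₚ)))
                     (cong (λ k → U⋆ (replicate k 0) (U⋆ (falling 0 t) oneₚ)) (ℕₚ.+-assoc n m i))) ⟩
    aCoeff i xs ℤ.* bellPoly [] (n + (m + i)) t K
      ≡⟨ cong (aCoeff i xs ℤ.*_) (bellPoly-expansion-rStirling2 [] t n (m + i) K) ⟩
    aCoeff i xs ℤ.* sumₚ n (λ j → rStirling2ℤ t n j ·ₚ bellPoly [] (m + i) (t + j)) K
      ≡⟨ sumₚ-· n (aCoeff i xs) _ K ⟨
    sumₚ n (λ j → aCoeff i xs ·ₚ (rStirling2ℤ t n j ·ₚ bellPoly [] (m + i) (t + j))) K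
      ≡⟨ sumₚ-cong n (λ j _ K → reassoc (aCoeff i xs) (rStirling2ℤ t n j) _) K ⟩
    sumₚ n (λ j → (rStirling2ℤ t n j ℤ.* aCoeff i xs) ·ₚ bellPoly [] (m + i) (t + j)) K ∎
    where
    reassoc : ∀ a s x → a ℤ.* (s ℤ.* x) ≡ (s ℤ.* a) ℤ.* x
    reassoc = ℤ-Solver.solve-∀

module ≈ₚ-Reasoning = SetoidReasoning (ℕ →-setoid ℤ)

shiftₚ : ℕ → Poly → Poly
shiftₚ t f k = f (k + t)

shiftₚ-cong : ∀ t {f g} → f ≈ₚ g → shiftₚ t f ≈ₚ shiftₚ t g
shiftₚ-cong t f≈g k = f≈g (k + t)

·ₚ-congʳ : ∀ a {f g} → f ≈ₚ g → (a ·ₚ f) ≈ₚ (a ·ₚ g)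
·ₚ-congʳ a f≈g k = cong (a ℤ.*_) (f≈g k)

shiftₚ-sum : ∀ n t F → shiftₚ t (sumₚ n F) ≈ₚ sumₚ n (λ j → shiftₚ t (F j))
shiftₚ-sum zero t F k = refl
shiftₚ-sum (suc n) t F k = cong (ℤ._+ F (suc n) (k + t)) (shiftₚ-sum n t F k)

zPow·-shiftₚ : ∀ t j g h → h ≈ₚ shiftₚ (t + j) g → VanishesBelow (t + j) g → (zPow· j) h ≈ₚ shiftₚ t g
zPow·-shiftₚ t j g h h≈g van k with j ℕ.≤? k
... | yes j≤k = trans (if-true _ _ (≤⇒≤ᵇ≡true j≤k)) (trans (h≈g (k ∸ j)) (cong g reindex))
  where
  reindex : k ∸ j + (t + j) ≡ k + t
  reindex = begin
    k ∸ j + (t + j) ≡⟨ cong (_+_ (k ∸ j)) (ℕₚ.+-comm t j) ⟩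
    k ∸ j + (j + t) ≡⟨ ℕₚ.+-assoc (k ∸ j) j t ⟨
    k ∸ j + j + t   ≡⟨ cong (_+ t) (ℕₚ.m∸n+n≡m j≤k) ⟩
    k + t           ∎
    where open ≡-Reasoning
... | no j≰k = trans (if-false _ _ (>⇒≤ᵇ≡false (ℕₚ.≰⇒> j≰k)))
                     (sym (van (k + t) (subst (k + t <_) (ℕₚ.+-comm j t) (ℕₚ.+-monoˡ-< t (ℕₚ.≰⇒> j≰k)))))

Vec-sum-∷ʳ : ∀ {q} (ys : Vec ℕ q) a → Vec.sum (ys Vec.∷ʳ a) ≡ Vec.sum ys + a
Vec-sum-∷ʳ Vec.[] a = ℕₚ.+-identityʳ a
Vec-sum-∷ʳ (y Vec.∷ ys) a = trans (cong (_+_ y) (Vec-sum-∷ʳ ys a)) (sym (ℕₚ.+-assoc y (Vec.sum ys) a))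

Vec-sum≡sum : ∀ {q} (ys : Vec ℕ q) → Vec.sum ys ≡ sum (toList ys)
Vec-sum≡sum Vec.[] = refl
Vec-sum≡sum (y Vec.∷ ys) = cong (_+_ y) (Vec-sum≡sum ys)

Bpoly-∷ʳ : ∀ {q} (ys : Vec ℕ q) a M → Bpoly M (ys Vec.∷ʳ a) ≈ₚ shiftₚ a (bellPoly (toList ys) M a)
Bpoly-∷ʳ ys a M k
  rewrite Vecₚ.init-∷ʳ a ys | Vecₚ.last-∷ʳ a ys | Vecₚ.toList-∷ʳ a ys | Vec-sum-∷ʳ ys a | Vec-sum≡sum ys
  with k ℕ.≤? M + sum (toList ys)
... | yes k≤ = trans (if-true _ _ (≤⇒≤ᵇ≡true k≤)) (stirlingPoly-bellPoly (toList ys) a M (k + a))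
... | no k≰ = trans (if-false _ _ (>⇒≤ᵇ≡false (ℕₚ.≰⇒> k≰)))
                    (sym (bellPoly-degree (toList ys) M a (k + a)
                           (subst (_< k + a) (ℕₚ.+-assoc M _ a) (ℕₚ.+-monoˡ-< a (ℕₚ.≰⇒> k≰)))))

rBell≈shiftₚ : ∀ M a → rBell M a ≈ₚ shiftₚ a (bellPoly [] M a)
rBell≈shiftₚ M a k with k ℕ.≤? M
... | yes k≤M = trans (if-true _ _ (≤⇒≤ᵇ≡true k≤M)) (stirlingPoly-bellPoly [] a M (k + a))
... | no k≰M = trans (if-false _ _ (>⇒≤ᵇ≡false (ℕₚ.≰⇒> k≰M)))
                     (sym (bellPoly-degree [] M a (k + a) (ℕₚ.+-monoˡ-< a (ℕₚ.≰⇒> k≰M))))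

module _ {q} (r : Vec ℕ (suc q)) where
  open ≈ₚ-Reasoning

  private
    t : ℕ
    t = last r
    xs : List ℕ
    xs = toList (init r)

  Bpoly≈shiftₚ : ∀ M → Bpoly M r ≈ₚ shiftₚ t (bellPoly xs M t)
  Bpoly≈shiftₚ M k = trans (cong (λ v → Bpoly M v k) (proj₂ (proj₂ (Vec.initLast r)))) (Bpoly-∷ʳ (init r) t M k)

  zPow·-Bpoly-addLast : ∀ j M → (zPow· j) (Bpoly M (addLast j r)) ≈ₚ shiftₚ t (bellPoly xs M (t + j))
  zPow·-Bpoly-addLast j M = zPow·-shiftₚ t j _ _ (Bpoly-∷ʳ (init r) (t + j) M) (bellPoly-vanishesBelow xs M (t + j))

  Bpoly-expansion-rStirling2 : ∀ n m →
    Bpoly (n + m) r ≈ₚ sumₚ n (λ j → rStirling2ℤ t n j ·ₚ (zPow· j) (Bpoly m (addLast j r)))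
  Bpoly-expansion-rStirling2 n m = begin
    Bpoly (n + m) r
      ≈⟨ Bpoly≈shiftₚ (n + m) ⟩
    shiftₚ t (bellPoly xs (n + m) t)
      ≈⟨ shiftₚ-cong t (bellPoly-expansion-rStirling2 xs t n m) ⟩
    shiftₚ t (sumₚ n (λ j → rStirling2ℤ t n j ·ₚ bellPoly xs m (t + j)))
      ≈⟨ shiftₚ-sum n t _ ⟩
    sumₚ n (λ j → rStirling2ℤ t n j ·ₚ shiftₚ t (bellPoly xs m (t + j)))
      ≈⟨ sumₚ-cong n (λ j _ → ·ₚ-congʳ (rStirling2ℤ t n j) (zPow·-Bpoly-addLast j m)) ⟨
    sumₚ n (λ j → rStirling2ℤ t n j ·ₚ (zPow· j) (Bpoly m (addLast j r))) ∎

  Bpoly-expansion-rBell : ∀ n m →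
    Bpoly (n + m) r ≈ₚ sumₚ (Vec.sum (init r)) (λ i → sumₚ n (λ j →
                          (rStirling2ℤ t n j ℤ.* aCoeff i xs) ·ₚ (zPow· j) (rBell (m + i) (t + j))))
  Bpoly-expansion-rBell n m = begin
    Bpoly (n + m) r
      ≈⟨ Bpoly≈shiftₚ (n + m) ⟩
    shiftₚ t (bellPoly xs (n + m) t)
      ≈⟨ shiftₚ-cong t (bellPoly-expansion-rBell xs t n m) ⟩
    shiftₚ t (sumₚ (sum xs) (λ i → sumₚ n (λ j → c i j ·ₚ bellPoly [] (m + i) (t + j))))
      ≈⟨ shiftₚ-sum (sum xs) t _ ⟩
    sumₚ (sum xs) (λ i → shiftₚ t (sumₚ n (λ j → c i j ·ₚ bellPoly [] (m + i) (t + j))))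
      ≈⟨ sumₚ-cong (sum xs) (λ i _ → shiftₚ-sum n t _) ⟩
    sumₚ (sum xs) (λ i → sumₚ n (λ j → c i j ·ₚ shiftₚ t (bellPoly [] (m + i) (t + j))))
      ≈⟨ sumₚ-cong (sum xs) (λ i _ → sumₚ-cong n (λ j _ → ·ₚ-congʳ (c i j) (zPow·-rBell i j))) ⟨
    sumₚ (sum xs) (λ i → sumₚ n (λ j → c i j ·ₚ (zPow· j) (rBell (m + i) (t + j))))
      ≡⟨ cong (λ S → sumₚ S (λ i → sumₚ n (λ j → c i j ·ₚ (zPow· j) (rBell (m + i) (t + j))))) (Vec-sum≡sum (init r)) ⟨
    sumₚ (Vec.sum (init r)) (λ i → sumₚ n (λ j → c i j ·ₚ (zPow· j) (rBell (m + i) (t + j)))) ∎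
    where
    c : ℕ → ℕ → ℤ
    c i j = rStirling2ℤ t n j ℤ.* aCoeff i xs
    zPow·-rBell : ∀ i j → (zPow· j) (rBell (m + i) (t + j)) ≈ₚ shiftₚ t (bellPoly [] (m + i) (t + j))
    zPow·-rBell i j = zPow·-shiftₚ t j _ _ (rBell≈shiftₚ (m + i) (t + j)) (bellPoly-vanishesBelow [] (m + i) (t + j))

  Bpoly-expansion-rStirling1 : ∀ n m →
    (zPow· n) (Bpoly m (addLast n r)) ≈ₚ sumₚ n (λ j → signedRStirling1 t n j ·ₚ Bpoly (m + j) r)
  Bpoly-expansion-rStirling1 n m = begin
    (zPow· n) (Bpoly m (addLast n r))
      ≈⟨ zPow·-Bpoly-addLast n m ⟩
    shiftₚ t (bellPoly xs m (t + n))
      ≈⟨ shiftₚ-cong t (bellPoly-expansion-rStirling1 xs t n m) ⟩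
    shiftₚ t (sumₚ n (λ j → signedRStirling1 t n j ·ₚ bellPoly xs (m + j) t))
      ≈⟨ shiftₚ-sum n t _ ⟩
    sumₚ n (λ j → signedRStirling1 t n j ·ₚ shiftₚ t (bellPoly xs (m + j) t))
      ≈⟨ sumₚ-cong n (λ j _ → ·ₚ-congʳ (signedRStirling1 t n j) (Bpoly≈shiftₚ (m + j))) ⟨
    sumₚ n (λ j → signedRStirling1 t n j ·ₚ Bpoly (m + j) r) ∎

theorem6 : (q : ℕ) (r : Vec ℕ (Data.Nat.suc q)) →
    (∀ (i j : Fin (Data.Nat.suc q)) → i Fin.≤ j → lookup r i ≤ lookup r j) →
    (n m : ℕ) →
    (Bpoly (n + m) r
      ≈ₚ sumₚ n (λ j → (+ rStirling2 (n + last r) (j + last r) (last r))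
                         ·ₚ (zPow· j) (Bpoly m (addLast j r))))
    × (Bpoly (n + m) r
      ≈ₚ sumₚ (Vec.sum (init r)) (λ i → sumₚ n (λ j →
           ((+ rStirling2 (n + last r) (j + last r) (last r)) ℤ.* aCoeff i (toList (init r)))
             ·ₚ (zPow· j) (rBell (m + i) (last r + j)))))
    × ((zPow· n) (Bpoly m (addLast n r))
      ≈ₚ sumₚ n (λ j → ((+ rStirling1 (n + last r) (j + last r) (last r)) ℤ.* signPow (n ∸ j))
                         ·ₚ Bpoly (m + j) r))
theorem6 q r _ n m = Bpoly-expansion-rStirling2 r n m , Bpoly-expansion-rBell r n m , Bpoly-expansion-rStirling1 r n m
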